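{- For every integer $k\geq 1$, $$\sum_{\iota\in F\mathcal{I}_{2k}(123)} q^{\mathrm{coinv}(\iota)} = \sum_{j=1}^k B_{2j+1,k-j}(q^2).$$
   Context: A permutation $\sigma$ of $[n]$ (one-line notation) contains a pattern $\pi\in\mathfrak{S}_k$ if some subsequence $\sigma(m_1)\cdots\sigma(m_k)$ with $m_1<\dots<m_k$ is in the same relative order as $\pi$; otherwise it avoids $\pi$. $F\mathcal{I}_n(\pi)$ is the set of fixed-point-free involutions ($\iota^2=\mathrm{id}$, $\iota(i)\neq i$ for all $i$) of $[n]$ avoiding $\pi$. $\mathrm{coinv}(\sigma)$ is the number of pairs $i<j$ with $\sigma(i)<\sigma(j)$. For positive integers $m$ and $\ell\ge 0$, $A_{m,\ell}$ is the set of sequences $(a_1,\dots,a_\ell)$ of positive integers such that: (1) $a_1\le m$; (2) if $a_1,\dots,a_i$ are all equal to $1$ then $a_{i+1}\le m+i$; (3) if $a_i\ne 1$ and $a_{i+1},\dots,a_{i+r}$ are all equal to $1$ (for some $r\ge 0$) then $a_{i+r+1}\le a_i+r$. (For $\ell=0$, $A_{m,0}$ consists of the empty sequence.) Let $B_{m,\ell}=\{(a_1,\dots,a_\ell)\in A_{m,\ell}: a_1\neq 1\}$ and $B_{m,\ell}(q)=\sum_{(a_1,\dots,a_\ell)\in B_{m,\ell}} q^{a_1+\dots+a_\ell-\ell}$. -}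

module Defs where

open import Data.Nat using (ℕ; zero; suc; _+_; _*_; _∸_; _≡ᵇ_; _≤ᵇ_; _<ᵇ_)
open import Data.Bool using (Bool; true; false; _∧_; _∨_; not; T)
open import Data.Fin using (Fin; toℕ)
open import Data.Fin.Properties using (_≟_)
open import Data.Vec using (Vec; []; _∷_; lookup)
open import Data.List using (List; allFin; length; filter; map)
open import Data.Bool.ListAction using (all; any)
open import Data.Nat.ListAction using (sum)
open import Data.Bool.Properties using (T?)
open import Data.Product using (Σ; _×_; _,_)
open import Relation.Nullary.Decidable using (⌊_⌋)

-- Permutations / involutions of [n] are given in one-line notation as
-- vectors of length n with entries in Fin n (positions and values 0-based).

_⟨_⟩ : ∀ {n} → Vec (Fin n) n → Fin n → Fin n
σ ⟨ i ⟩ = lookup σ i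
infixl 30 _⟨_⟩

_<ꟳ_ : ∀ {n} → Fin n → Fin n → Bool
i <ꟳ j = toℕ i <ᵇ toℕ j
infix 10 _<ꟳ_

-- fixed-point-free involution: ι(ι(i)) = i and ι(i) ≠ i for all i
-- (ι² = id already forces ι to be a permutation)
isFPFInvolution : ∀ {n} → Vec (Fin n) n → Bool
isFPFInvolution {n} ι =
  all (λ i → ⌊ ι ⟨ ι ⟨ i ⟩ ⟩ ≟ i ⌋ ∧ not ⌊ ι ⟨ i ⟩ ≟ i ⌋) (allFin n)

contains123 : ∀ {n} → Vec (Fin n) n → Bool
contains123 {n} σ =
  any (λ i → any (λ j → any (λ l →
        (i <ꟳ j) ∧ (j <ꟳ l) ∧ (σ ⟨ i ⟩ <ꟳ σ ⟨ j ⟩) ∧ (σ ⟨ j ⟩ <ꟳ σ ⟨ l ⟩))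
      (allFin n)) (allFin n)) (allFin n)

inFI123 : ∀ {n} → Vec (Fin n) n → Bool
inFI123 ι = isFPFInvolution ι ∧ not (contains123 ι)

coinv : ∀ {n} → Vec (Fin n) n → ℕ
coinv {n} σ =
  sum (map (λ i →
    length (filter (λ j → T? ((i <ꟳ j) ∧ (σ ⟨ i ⟩ <ꟳ σ ⟨ j ⟩))) (allFin n)))
    (allFin n))

-- Membership in A_{m,ℓ}.  'checkA b a' checks the remaining sequence a,
-- where b is the current upper bound for the next entry:
--   * initially b = m                                   (condition (1))
--   * while all entries read so far are 1, b = m + i    (condition (2))
--   * after a last entry a_i ≠ 1 followed by r ones,
--     b = a_i + r                                       (condition (3))
-- i.e. after reading an entry x the bound becomes b+1 if x = 1 and x otherwise.
checkA : ∀ {ℓ} → ℕ → Vec ℕ ℓ → Bool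
checkA b [] = true
checkA b (x ∷ xs) =
  (1 ≤ᵇ x) ∧ (x ≤ᵇ b) ∧ checkA (if' (x ≡ᵇ 1) (suc b) x) xs
  where
  if' : Bool → ℕ → ℕ → ℕ
  if' true  u v = u
  if' false u v = v

inA : (m : ℕ) {ℓ : ℕ} → Vec ℕ ℓ → Bool
inA m a = checkA m a

inB : (m : ℕ) {ℓ : ℕ} → Vec ℕ ℓ → Bool
inB m [] = inA m []
inB m (x ∷ xs) = inA m (x ∷ xs) ∧ not (x ≡ᵇ 1)

-- the exponent a_1 + ... + a_ℓ - ℓ of q
weightB : ∀ {ℓ} → Vec ℕ ℓ → ℕ
weightB {ℓ} a = Data.Vec.sum a ∸ ℓ
  where import Data.Vec

module Submission where

open import Defs
open import Data.Nat using (ℕ; suc; _+_; _*_; _∸_; _≡ᵇ_)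
open import Data.Bool using (_∧_; T)
open import Data.Fin using (Fin; toℕ)
open import Data.Vec using (Vec)
open import Data.Product using (Σ)
open import Function.Bundles using (_↔_)

open import Data.Nat using (zero; _≤_; _<_; z≤n; s≤s; z<s; _<ᵇ_; _≤ᵇ_; pred; >-nonZero)
open import Data.Nat.Properties hiding (_≟_)
open import Data.Bool using (Bool; true; false; if_then_else_; not)
open import Data.Bool.Properties using (T-irrelevant; T?; ∧-assoc; ∧-identityʳ)
open import Data.Empty using (⊥-elim)
open import Data.Unit using (⊤; tt)
open import Data.Sum using (_⊎_; inj₁; inj₂)
open import Data.Product using (_×_; _,_; proj₁; proj₂)
open import Data.Fin using (fromℕ<) renaming (zero to fzero; suc to fsuc)
open import Data.Fin.Properties using (toℕ<n; toℕ-fromℕ<; fromℕ<-toℕ; toℕ-injective; _≟_)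
open import Data.Vec using ([]; _∷_; lookup; toList)
import Data.Vec as Vec
open import Data.List using (List; []; _∷_; length; null; _++_; reverse; allFin; filter; tabulate)
open import Data.List.Properties using (unfold-reverse; reverse-involutive; length-reverse; map-tabulate; ∷-injectiveˡ; ∷-injectiveʳ)
open import Data.List.Relation.Unary.All.Properties using (all⁺; all⁻; tabulate⁺; tabulate⁻)
open import Data.List.Relation.Unary.Any.Properties using (any⁺; any⁻)
open import Data.List.Relation.Unary.Any using (satisfied)
open import Data.List.Membership.Propositional using (lose)
open import Data.List.Membership.Propositional.Properties using (∈-allFin)
open import Data.Nat.ListAction using (sum)
open import Data.Product.Function.Dependent.Propositional using (Σ-↔)
open import Function.Bundles using (Inverse; mk↔ₛ′)
open import Function.Properties.Inverse using (↔-refl; ↔-trans; ↔-sym)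
open import Data.Product.Algebra using (Σ-assoc-alt)
open import Relation.Binary.PropositionalEquality
open import Relation.Binary.Definitions using (tri<; tri≈; tri>)
open import Relation.Nullary using (¬_)
open import Function using (_∘′_)
open import Relation.Nullary.Decidable using (⌊_⌋; fromWitness; toWitness)

-- Write FI(n) for the 123-avoiding fixed-point-free
-- involutions of [n] and L(ι) for the length of the longest non-increasing
-- prefix of ι.  Every τ ∈ FI(n+2) arises from exactly one pair (ι , p) with
-- ι ∈ FI(n) and p ≤ L(ι): match the new last position with a new value p,
-- i.e. insert the 2-cycle (p n+1).  This raises coinv by 2p, and the new
-- prefix length is p when p > 0, and L(ι)+1 (resp. n+2 when ι was entirely
-- non-increasing) when p = 0.  Reading a sequence of B_{2j+3,ℓ} backwards,
-- the same recursion appears: appending p+1 (p below the current bound) adds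
-- p to the weight, and the new bound minus one obeys the same update rule,
-- where "ι non-increasing" corresponds to "the sequence is empty".

-- §1  Finite sums and the shift map.

if-true : ∀ {A : Set} (b : Bool) {x y : A} → T b → (if b then x else y) ≡ x
if-true true _ = refl

if-false : ∀ {A : Set} (b : Bool) {x y : A} → ¬ T b → (if b then x else y) ≡ y
if-false false _ = refl
if-false true ¬t = ⊥-elim (¬t tt)

≤⇒¬<ᵇ : ∀ {a b} → b ≤ a → ¬ T (a <ᵇ b)
≤⇒¬<ᵇ {a} {b} le t = <⇒≱ (<ᵇ⇒< a b t) le

≢⇒¬≡ᵇ : ∀ {a b} → a ≢ b → ¬ T (a ≡ᵇ b)
≢⇒¬≡ᵇ {a} {b} ne t = ne (≡ᵇ⇒≡ a b t)

T-ext : ∀ {a b : Bool} → (T a → T b) → (T b → T a) → a ≡ b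
T-ext {false} {false} f g = refl
T-ext {false} {true} f g = ⊥-elim (g tt)
T-ext {true} {false} f g = ⊥-elim (f tt)
T-ext {true} {true} f g = refl

T-∧₁ : ∀ a b → T (a ∧ b) → T a
T-∧₁ true _ _ = tt

T-∧₂ : ∀ a b → T (a ∧ b) → T b
T-∧₂ true _ t = t

∧-intro : ∀ a b → T a → T b → T (a ∧ b)
∧-intro true _ _ t = t

T-not : ∀ {a} → T (not a) → ¬ T a
T-not {false} _ ()

not-T : ∀ {a} → ¬ T a → T (not a)
not-T {false} _ = tt
not-T {true} h = h tt

∧-false₂ : ∀ a {b} → ¬ T b → (a ∧ b) ≡ false
∧-false₂ false _ = refl
∧-false₂ true {false} _ = refl
∧-false₂ true {true} ¬t = ⊥-elim (¬t tt)

∧-false₁ : ∀ {a} b → ¬ T a → (a ∧ b) ≡ false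
∧-false₁ {false} b _ = refl
∧-false₁ {true} b ¬t = ⊥-elim (¬t tt)

∧-true₁ : ∀ {a} b → T a → (a ∧ b) ≡ b
∧-true₁ {true} b _ = refl

∧-true₂ : ∀ a {b} → T b → (a ∧ b) ≡ a
∧-true₂ false _ = refl
∧-true₂ true {true} _ = refl

χ : Bool → ℕ
χ b = if b then 1 else 0

∑ : ℕ → (ℕ → ℕ) → ℕ
∑ zero h = 0
∑ (suc m) h = h 0 + ∑ m (λ i → h (suc i))

∑-cong : ∀ m {h h' : ℕ → ℕ} → (∀ i → i < m → h i ≡ h' i) → ∑ m h ≡ ∑ m h'
∑-cong zero e = refl
∑-cong (suc m) e = cong₂ _+_ (e 0 z<s) (∑-cong m (λ i i<m → e (suc i) (s≤s i<m)))

∑-last : ∀ m (h : ℕ → ℕ) → ∑ (suc m) h ≡ ∑ m h + h m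
∑-last zero h = +-comm (h 0) 0
∑-last (suc m) h = trans (cong (h 0 +_) (∑-last m (λ i → h (suc i)))) (sym (+-assoc (h 0) _ _))

∑-+ : ∀ m (f g : ℕ → ℕ) → ∑ m (λ i → f i + g i) ≡ ∑ m f + ∑ m g
∑-+ zero f g = refl
∑-+ (suc m) f g = trans (cong (f 0 + g 0 +_) (∑-+ m (λ i → f (suc i)) (λ i → g (suc i))))
  (+-+-comm (f 0) (g 0) _ _)
  where
  +-+-comm : ∀ a b c d → a + b + (c + d) ≡ a + c + (b + d)
  +-+-comm a b c d = trans (+-assoc a b (c + d)) (trans (cong (a +_) (+-comm-middle b c d))
    (sym (+-assoc a c (b + d))))
    where
    +-comm-middle : ∀ b c d → b + (c + d) ≡ c + (b + d)
    +-comm-middle b c d = trans (sym (+-assoc b c d)) (trans (cong (_+ d) (+-comm b c)) (+-assoc c b d))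

∑-zero : ∀ m {h : ℕ → ℕ} → (∀ i → i < m → h i ≡ 0) → ∑ m h ≡ 0
∑-zero zero e = refl
∑-zero (suc m) e = cong₂ _+_ (e 0 z<s) (∑-zero m (λ i i<m → e (suc i) (s≤s i<m)))

-- skip p is the increasing bijection ℕ → ℕ ∖ {p}: it fixes i < p and shifts i ≥ p.
skip : ℕ → ℕ → ℕ
skip p i = if i <ᵇ p then i else suc i

skip-suc : ∀ p i → skip (suc p) (suc i) ≡ suc (skip p i)
skip-suc p i with i <ᵇ p
... | true = refl
... | false = refl

∑-skip : ∀ m p (h : ℕ → ℕ) → p ≤ m → ∑ (suc m) h ≡ ∑ m (λ i → h (skip p i)) + h p
∑-skip m zero h _ = +-comm (h 0) _
∑-skip (suc m) (suc p) h (s≤s p≤m) = begin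
    h 0 + ∑ (suc m) (λ i → h (suc i))
  ≡⟨ cong (h 0 +_) (∑-skip m p (λ i → h (suc i)) p≤m) ⟩
    h 0 + (∑ m (λ i → h (suc (skip p i))) + h (suc p))
  ≡⟨ sym (+-assoc (h 0) _ _) ⟩
    h 0 + ∑ m (λ i → h (suc (skip p i))) + h (suc p)
  ≡⟨ cong (λ z → h 0 + z + h (suc p)) (∑-cong m (λ i _ → cong h (sym (skip-suc p i)))) ⟩
    h 0 + ∑ m (λ i → h (skip (suc p) (suc i))) + h (suc p) ∎
  where open ≡-Reasoning

∑-χ< : ∀ m p → p ≤ m → ∑ m (λ i → χ (i <ᵇ p)) ≡ p
∑-χ< m zero _ = ∑-zero m (λ i _ → refl)
∑-χ< (suc m) (suc p) (s≤s le) = cong suc (∑-χ< m p le)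

skip-lt : ∀ {p a} → a < p → skip p a ≡ a
skip-lt {p} {a} lt = if-true (a <ᵇ p) (<⇒<ᵇ lt)

skip-ge : ∀ {p a} → p ≤ a → skip p a ≡ suc a
skip-ge {p} {a} le = if-false (a <ᵇ p) (≤⇒¬<ᵇ le)

skip-mono≤ : ∀ p {a b} → a ≤ b → skip p a ≤ skip p b
skip-mono≤ p {a} {b} le with <-≤-connex a p | <-≤-connex b p
... | inj₁ x | inj₁ y = subst₂ _≤_ (sym (skip-lt x)) (sym (skip-lt y)) le
... | inj₁ x | inj₂ y = subst₂ _≤_ (sym (skip-lt x)) (sym (skip-ge y)) (≤-trans le (n≤1+n b))
... | inj₂ x | inj₁ y = ⊥-elim (<-irrefl refl (<-≤-trans (≤-<-trans le y) x))
... | inj₂ x | inj₂ y = subst₂ _≤_ (sym (skip-ge x)) (sym (skip-ge y)) (s≤s le)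

skip-mono< : ∀ p {a b} → a < b → skip p a < skip p b
skip-mono< p {a} {b} lt with <-≤-connex a p | <-≤-connex b p
... | inj₁ x | inj₁ y = subst₂ _<_ (sym (skip-lt x)) (sym (skip-lt y)) lt
... | inj₁ x | inj₂ y = subst₂ _<_ (sym (skip-lt x)) (sym (skip-ge y)) (≤-trans lt (n≤1+n b))
... | inj₂ x | inj₁ y = ⊥-elim (<-irrefl refl (<-≤-trans (<-trans lt y) x))
... | inj₂ x | inj₂ y = subst₂ _<_ (sym (skip-ge x)) (sym (skip-ge y)) (s≤s lt)

skip-reflects< : ∀ p {a b} → skip p a < skip p b → a < b
skip-reflects< p {a} {b} lt with <-≤-connex a b
... | inj₁ x = x
... | inj₂ y = ⊥-elim (<⇒≱ lt (skip-mono≤ p y))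

skip-reflects≤ : ∀ p {a b} → skip p a ≤ skip p b → a ≤ b
skip-reflects≤ p {a} {b} le with <-≤-connex b a
... | inj₁ x = ⊥-elim (<⇒≱ (skip-mono< p x) le)
... | inj₂ y = y

skip-injective : ∀ p {a b} → skip p a ≡ skip p b → a ≡ b
skip-injective p e = ≤-antisym (skip-reflects≤ p (≤-reflexive e)) (skip-reflects≤ p (≤-reflexive (sym e)))

skip≢ : ∀ p a → skip p a ≢ p
skip≢ p a e with <-≤-connex a p
... | inj₁ x = <-irrefl (trans (sym (skip-lt x)) e) x
... | inj₂ y = <-irrefl (sym e) (subst (p <_) (sym (skip-ge y)) (s≤s y))

skip<⇒< : ∀ p a → skip p a < p → a < p
skip<⇒< p a lt with <-≤-connex a p
... | inj₁ x = x
... | inj₂ y = ⊥-elim (<⇒≱ lt (subst (p ≤_) (sym (skip-ge y)) (≤-trans y (n≤1+n a))))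

skip-bound : ∀ p {a n} → a < n → skip p a < suc n
skip-bound p {a} lt with <-≤-connex a p
... | inj₁ x = subst (_< _) (sym (skip-lt x)) (≤-trans lt (n≤1+n _))
... | inj₂ y = subst (_< _) (sym (skip-ge y)) (s≤s lt)

skip-bound⁻ : ∀ p {a n} → p ≤ n → skip p a < suc n → a < n
skip-bound⁻ p {a} p≤n lt with <-≤-connex a p
... | inj₁ x = <-≤-trans x p≤n
... | inj₂ y = ≤-pred (subst (_< _) (skip-ge y) lt)

skip-<ᵇ : ∀ p a b → (skip p a <ᵇ skip p b) ≡ (a <ᵇ b)
skip-<ᵇ p a b = T-ext (λ t → <⇒<ᵇ (skip-reflects< p (<ᵇ⇒< _ _ t))) (λ t → <⇒<ᵇ (skip-mono< p (<ᵇ⇒< _ _ t)))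

skip-<ᵇp : ∀ p a → (skip p a <ᵇ p) ≡ (a <ᵇ p)
skip-<ᵇp p a = T-ext (λ t → <⇒<ᵇ (skip<⇒< p a (<ᵇ⇒< _ _ t)))
  (λ t → <⇒<ᵇ (subst (_< p) (sym (skip-lt {p} (<ᵇ⇒< a p t))) (<ᵇ⇒< a p t)))

unskip : ℕ → ℕ → ℕ
unskip p v = if v <ᵇ p then v else pred v

unskip-skip : ∀ p a → unskip p (skip p a) ≡ a
unskip-skip p a with <-≤-connex a p
... | inj₁ x = trans (cong (unskip p) (skip-lt x)) (if-true (a <ᵇ p) (<⇒<ᵇ x))
... | inj₂ y = trans (cong (unskip p) (skip-ge y)) (if-false (suc a <ᵇ p) (≤⇒¬<ᵇ (≤-trans y (n≤1+n a))))

skip-unskip : ∀ p v → v ≢ p → skip p (unskip p v) ≡ v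
skip-unskip p v ne with <-≤-connex v p
... | inj₁ x = trans (cong (skip p) (if-true (v <ᵇ p) (<⇒<ᵇ x))) (skip-lt x)
skip-unskip p zero ne | inj₂ y = ⊥-elim (ne (sym (n≤0⇒n≡0 y)))
skip-unskip p (suc v) ne | inj₂ y =
  trans (cong (skip p) (if-false (suc v <ᵇ p) (≤⇒¬<ᵇ y))) (skip-ge (≤-pred (≤∧≢⇒< y (ne ∘′ sym))))


skip-view : ∀ {m} p j → j < suc m → p ≤ m → (j ≡ p) ⊎ Σ ℕ (λ i → (i < m) × (j ≡ skip p i))
skip-view {m} p j lt le with <-cmp j p
... | tri< a _ _ = inj₂ (j , <-≤-trans a le , sym (skip-lt a))
... | tri≈ _ b _ = inj₁ b
skip-view {m} p zero lt le | tri> _ _ c = ⊥-elim (n≮0 c)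
skip-view {m} p (suc j) lt le | tri> _ _ c = inj₂ (j , ≤-pred lt , sym (skip-ge (≤-pred c)))

∑-single : ∀ m i₀ (h : ℕ → ℕ) → i₀ < m → h i₀ ≡ 1 → (∀ i → i < m → i ≢ i₀ → h i ≡ 0) → ∑ m h ≡ 1
∑-single (suc m) i₀ h (s≤s i₀≤m) e1 e0 = begin
    ∑ (suc m) h
  ≡⟨ ∑-skip m i₀ h i₀≤m ⟩
    ∑ m (λ i → h (skip i₀ i)) + h i₀
  ≡⟨ cong₂ _+_ (∑-zero m (λ i i<m → e0 (skip i₀ i) (skip-bound i₀ i<m) (skip≢ i₀ i))) e1 ⟩
    1 ∎
  where open ≡-Reasoning

-- §2  Involutions of [n] as functions ℕ → ℕ.

IsFPInv : ℕ → (ℕ → ℕ) → Set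
IsFPInv n F = ∀ i → i < n → (F i < n) × (F (F i) ≡ i) × (F i ≢ i)

Has123 : ℕ → (ℕ → ℕ) → Set
Has123 n F = Σ ℕ λ i → Σ ℕ λ j → Σ ℕ λ l →
  (i < j) × (j < l) × (l < n) × (F i < F j) × (F j < F l)

IsFI123 : ℕ → (ℕ → ℕ) → Set
IsFI123 n F = IsFPInv n F × ¬ Has123 n F

AntitoneBelow : (ℕ → ℕ) → ℕ → Set
AntitoneBelow F q = ∀ i j → i < j → j < q → F j ≤ F i

-- Inserting the 2-cycle (p n+1) into F on [0, n): position p and value p are
-- inserted (the old entries are renumbered by skip p), and the new last
-- position n+1 is matched with p.
insertPair : (ℕ → ℕ) → ℕ → ℕ → ℕ → ℕ
insertPair F p n j = if j ≡ᵇ suc n then p else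
  (if j <ᵇ p then skip p (F j) else (if j ≡ᵇ p then suc n else skip p (F (pred j))))

-- The inverse operation on [0, n+2): delete the last position and its partner.
removeLastPair : (ℕ → ℕ) → ℕ → ℕ → ℕ
removeLastPair G n j = unskip (G (suc n)) (G (skip (G (suc n)) j))

module _ (F : ℕ → ℕ) (p n : ℕ) (p≤n : p ≤ n) where
  private G = insertPair F p n

  insert-last : G (suc n) ≡ p
  insert-last = if-true (suc n ≡ᵇ suc n) (≡⇒≡ᵇ (suc n) (suc n) refl)

  insert-at-p : G p ≡ suc n
  insert-at-p = trans (if-false (p ≡ᵇ suc n) (≢⇒¬≡ᵇ (λ e → <-irrefl e (s≤s p≤n))))
    (trans (if-false (p <ᵇ p) (≤⇒¬<ᵇ {p} {p} ≤-refl)) (if-true (p ≡ᵇ p) (≡⇒≡ᵇ p p refl)))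

  insert-skip : ∀ i → i < n → G (skip p i) ≡ skip p (F i)
  insert-skip i i<n with <-≤-connex i p
  ... | inj₁ x = begin
        G (skip p i) ≡⟨ cong G (skip-lt x) ⟩
        G i ≡⟨ if-false (i ≡ᵇ suc n) (≢⇒¬≡ᵇ (λ e → <-irrefl e (≤-trans i<n (n≤1+n n)))) ⟩
        _ ≡⟨ if-true (i <ᵇ p) (<⇒<ᵇ x) ⟩
        skip p (F i) ∎
    where open ≡-Reasoning
  ... | inj₂ y = begin
        G (skip p i) ≡⟨ cong G (skip-ge y) ⟩
        G (suc i) ≡⟨ if-false (suc i ≡ᵇ suc n) (≢⇒¬≡ᵇ (λ e → <-irrefl e (s≤s i<n))) ⟩
        _ ≡⟨ if-false (suc i <ᵇ p) (≤⇒¬<ᵇ (≤-trans y (n≤1+n i))) ⟩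
        _ ≡⟨ if-false (suc i ≡ᵇ p) (≢⇒¬≡ᵇ (λ e → <-irrefl (sym e) (s≤s y))) ⟩
        skip p (F i) ∎
    where open ≡-Reasoning

  insert-view : ∀ j → j < suc (suc n) →
    (j ≡ suc n) ⊎ ((j ≡ p) ⊎ Σ ℕ (λ i → (i < n) × (j ≡ skip p i)))
  insert-view j lt with m≤n⇒m<n∨m≡n (≤-pred lt)
  ... | inj₂ e = inj₁ e
  ... | inj₁ lt' = inj₂ (skip-view p j lt' p≤n)

  remove-insert : ∀ i → i < n → removeLastPair G n i ≡ F i
  remove-insert i i<n = begin
      unskip (G (suc n)) (G (skip (G (suc n)) i))
    ≡⟨ cong (λ q → unskip q (G (skip q i))) insert-last ⟩
      unskip p (G (skip p i))
    ≡⟨ cong (unskip p) (insert-skip i i<n) ⟩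
      unskip p (skip p (F i))
    ≡⟨ unskip-skip p (F i) ⟩
      F i ∎
    where open ≡-Reasoning

  insert-inv : IsFPInv n F → IsFPInv (suc (suc n)) G
  insert-inv I j lt with insert-view j lt
  ... | inj₁ refl = subst (_< suc (suc n)) (sym insert-last) (s≤s (≤-trans p≤n (n≤1+n n))) ,
                    trans (cong G insert-last) insert-at-p ,
                    λ e → <-irrefl (trans (sym insert-last) e) (s≤s p≤n)
  ... | inj₂ (inj₁ refl) = subst (_< suc (suc n)) (sym insert-at-p) ≤-refl ,
                    trans (cong G insert-at-p) insert-last ,
                    λ e → <-irrefl (trans (sym e) insert-at-p) (s≤s p≤n)
  ... | inj₂ (inj₂ (i , i<n , refl)) with I i i<n
  ...   | Fi<n , FFi , fp =
      subst (_< suc (suc n)) (sym (insert-skip i i<n)) (≤-trans (skip-bound p Fi<n) (n≤1+n _)) ,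
      trans (cong G (insert-skip i i<n)) (trans (insert-skip (F i) Fi<n) (cong (skip p) FFi)) ,
      λ e → fp (skip-injective p (trans (sym (insert-skip i i<n)) e))

  -- If F avoids 123 and is non-increasing below p, inserting (p n+1) creates
  -- no 123.  An occurrence i < j < l must have l = n+1 or l = p, since G i and
  -- G j are old values.  If l = n+1 then F i < F j < p, and antitonicity at
  -- the positions F i < F j gives j = F (F j) ≤ F (F i) = i; if l = p then
  -- i < j < p is an ascent of F below p.
  insert-avoids : IsFI123 n F → AntitoneBelow F p → ¬ Has123 (suc (suc n)) G
  insert-avoids (I , avoids) antitone (i , j , l , i<j , j<l , l<N , gij , gjl)
    with asSkip i (<-trans i<j j<sn) gi | asSkip j j<sn gj
    where
    gj : G j < suc n
    gj = <-≤-trans gjl (≤-pred (proj₁ (insert-inv I l l<N)))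
    gi : G i < suc n
    gi = <-trans gij gj
    j<sn : j < suc n
    j<sn = <-≤-trans j<l (≤-pred l<N)
    asSkip : ∀ x → x < suc n → G x < suc n → Σ ℕ (λ x' → (x' < n) × (x ≡ skip p x'))
    asSkip x lt gl with skip-view p x lt p≤n
    ... | inj₁ refl = ⊥-elim (<-irrefl insert-at-p gl)
    ... | inj₂ r = r
  ... | (i' , i'<n , refl) | (j' , j'<n , refl) with insert-view l l<N
  ...   | inj₁ refl = <⇒≱ i'<j' (subst₂ _≤_ (proj₁ (proj₂ (I j' j'<n))) (proj₁ (proj₂ (I i' i'<n)))
                        (antitone (F i') (F j') Fij Fj<p))
    where
    i'<j' = skip-reflects< p i<j
    Fij = skip-reflects< p (subst₂ _<_ (insert-skip i' i'<n) (insert-skip j' j'<n) gij)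
    Fj<p = skip<⇒< p (F j') (subst₂ _<_ (insert-skip j' j'<n) insert-last gjl)
  ...   | inj₂ (inj₁ refl) = <⇒≱ Fij (antitone i' j' (skip-reflects< p i<j) (skip<⇒< p j' j<l))
    where Fij = skip-reflects< p (subst₂ _<_ (insert-skip i' i'<n) (insert-skip j' j'<n) gij)
  ...   | inj₂ (inj₂ (l' , l'<n , refl)) =
    avoids (i' , j' , l' , skip-reflects< p i<j , skip-reflects< p j<l , l'<n ,
            skip-reflects< p (subst₂ _<_ (insert-skip i' i'<n) (insert-skip j' j'<n) gij) ,
            skip-reflects< p (subst₂ _<_ (insert-skip j' j'<n) (insert-skip l' l'<n) gjl))

  insert-valid : IsFI123 n F → AntitoneBelow F p → IsFI123 (suc (suc n)) G
  insert-valid V antitone = insert-inv (proj₁ V) , insert-avoids V antitone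

-- Conversely, every τ ∈ FI_{n+2}(123) is obtained by insertion from its
-- restriction removeLastPair τ n, with p = τ(n+1).
module _ (G : ℕ → ℕ) (n : ℕ) (V : IsFI123 (suc (suc n)) G) where
  private
    I = proj₁ V
    p = G (suc n)
    F = removeLastPair G n
    N = suc (suc n)
    sn<N : suc n < N
    sn<N = ≤-refl

  last-partner≤ : G (suc n) ≤ n
  last-partner≤ = ≤-pred (≤∧≢⇒< (≤-pred (proj₁ (I (suc n) sn<N))) (proj₂ (proj₂ (I (suc n) sn<N))))

  private
    p<N : p < N
    p<N = ≤-trans (s≤s last-partner≤) (n≤1+n _)
    Gp : G p ≡ suc n
    Gp = proj₁ (proj₂ (I (suc n) sn<N))
    top-unique : ∀ x → x < N → G x ≡ suc n → x ≡ p
    top-unique x lt e = trans (sym (proj₁ (proj₂ (I x lt)))) (cong G e)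
    p-unique : ∀ x → x < N → G x ≡ p → x ≡ suc n
    p-unique x lt e = trans (sym (proj₁ (proj₂ (I x lt)))) (trans (cong G e) Gp)

    module Old (i : ℕ) (i<n : i < n) where
      x = skip p i
      x<sn : x < suc n
      x<sn = skip-bound p i<n
      x<N : x < N
      x<N = ≤-trans x<sn (n≤1+n _)
      Gx<sn : G x < suc n
      Gx<sn = ≤∧≢⇒< (≤-pred (proj₁ (I x x<N))) (λ e → skip≢ p i (top-unique x x<N e))
      skip-F : skip p (F i) ≡ G x
      skip-F = skip-unskip p (G x) (λ e → <-irrefl (p-unique x x<N e) x<sn)
      Fi<n : F i < n
      Fi<n = skip-bound⁻ p last-partner≤ (subst (_< suc n) (sym skip-F) Gx<sn)

  open Old

  remove-inv : IsFPInv n F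
  remove-inv i i<n = Fi<n i i<n , FF , fp
    where
    FF : F (F i) ≡ i
    FF = skip-injective p (trans (skip-F (F i) (Fi<n i i<n))
           (trans (cong G (skip-F i i<n)) (proj₁ (proj₂ (I (x i i<n) (x<N i i<n))))))
    fp : F i ≢ i
    fp e = proj₂ (proj₂ (I (x i i<n) (x<N i i<n))) (trans (sym (skip-F i i<n)) (cong (skip p) e))

  remove-avoids : ¬ Has123 n F
  remove-avoids (i , j , l , i<j , j<l , l<n , fij , fjl) =
    proj₂ V (x i i<n , x j j<n , x l l<n , skip-mono< p i<j , skip-mono< p j<l , x<N l l<n ,
      subst₂ _<_ (skip-F i i<n) (skip-F j j<n) (skip-mono< p fij) ,
      subst₂ _<_ (skip-F j j<n) (skip-F l l<n) (skip-mono< p fjl))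
    where
    j<n = <-trans j<l l<n
    i<n = <-trans i<j j<n

  remove-valid : IsFI123 n F
  remove-valid = remove-inv , remove-avoids

  -- An ascent of F below p would form a 123 with the entry p ↦ n+1 of G.
  remove-antitone : AntitoneBelow F p
  remove-antitone i j i<j j<p with <-≤-connex (F i) (F j)
  ... | inj₂ y = y
  ... | inj₁ lt = ⊥-elim (proj₂ V (x i i<n , x j j<n , p , skip-mono< p i<j ,
          subst (_< p) (sym (skip-lt j<p)) j<p , p<N ,
          subst₂ _<_ (skip-F i i<n) (skip-F j j<n) (skip-mono< p lt) ,
          subst (G (x j j<n) <_) (sym Gp) (Gx<sn j j<n)))
    where
    j<n = <-≤-trans j<p last-partner≤
    i<n = <-trans i<j j<n

  insert-remove : ∀ j → j < N → insertPair F p n j ≡ G j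
  insert-remove j lt with insert-view F p n last-partner≤ j lt
  ... | inj₁ refl = insert-last F p n last-partner≤
  ... | inj₂ (inj₁ refl) = trans (insert-at-p F p n last-partner≤) (sym Gp)
  ... | inj₂ (inj₂ (i , i<n , refl)) = trans (insert-skip F p n last-partner≤ i i<n) (skip-F i i<n)

coinvF : ℕ → (ℕ → ℕ) → ℕ
coinvF m F = ∑ m (λ i → ∑ m (λ j → χ ((i <ᵇ j) ∧ (F i <ᵇ F j))))

χ-<suc : ∀ a q → χ (a <ᵇ suc q) ≡ χ (a <ᵇ q) + χ (a ≡ᵇ q)
χ-<suc zero zero = refl
χ-<suc zero (suc q) = refl
χ-<suc (suc a) zero = refl
χ-<suc (suc a) (suc q) = χ-<suc a q

count-values< : ∀ n F → IsFPInv n F → ∀ p → p ≤ n → ∑ n (λ i → χ (F i <ᵇ p)) ≡ p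
count-values< n F I zero _ = ∑-zero n (λ i _ → refl)
count-values< n F I (suc q) q<n = begin
    ∑ n (λ i → χ (F i <ᵇ suc q))
  ≡⟨ ∑-cong n (λ i _ → χ-<suc (F i) q) ⟩
    ∑ n (λ i → χ (F i <ᵇ q) + χ (F i ≡ᵇ q))
  ≡⟨ ∑-+ n (λ i → χ (F i <ᵇ q)) (λ i → χ (F i ≡ᵇ q)) ⟩
    ∑ n (λ i → χ (F i <ᵇ q)) + ∑ n (λ i → χ (F i ≡ᵇ q))
  ≡⟨ cong₂ _+_ (count-values< n F I q (≤-trans (n≤1+n q) q<n)) one-preimage ⟩
    q + 1
  ≡⟨ +-comm q 1 ⟩
    suc q ∎
  where
  open ≡-Reasoning
  one-preimage : ∑ n (λ i → χ (F i ≡ᵇ q)) ≡ 1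
  one-preimage = ∑-single n (F q) (λ i → χ (F i ≡ᵇ q)) (proj₁ (I q q<n))
    (if-true (F (F q) ≡ᵇ q) (≡⇒≡ᵇ _ _ (proj₁ (proj₂ (I q q<n)))))
    (λ i i<n ne → if-false (F i ≡ᵇ q) (λ t → ne (trans (sym (proj₁ (proj₂ (I i i<n))))
       (cong F (≡ᵇ⇒≡ _ _ t)))))

-- Inserting (p n+1) raises coinv by 2p: the new entry p ↦ n+1 is the
-- larger entry of p coinversions (one with each earlier position), and the new
-- entry n+1 ↦ p the larger one of p coinversions (one with each smaller value).
coinv-insert : ∀ n F p → IsFPInv n F → p ≤ n →
  coinvF (suc (suc n)) (insertPair F p n) ≡ coinvF n F + p + p
coinv-insert n F p I p≤n = begin
    ∑ (suc (suc n)) (λ i → ∑ (suc (suc n)) (c i))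
  ≡⟨ ∑-last (suc n) (λ i → ∑ (suc (suc n)) (c i)) ⟩
    ∑ (suc n) (λ i → ∑ (suc (suc n)) (c i)) + ∑ (suc (suc n)) (c (suc n))
  ≡⟨ cong₂ _+_ (∑-cong (suc n) (λ i _ → ∑-last (suc n) (c i))) last-row ⟩
    ∑ (suc n) (λ i → ∑ (suc n) (c i) + c i (suc n)) + 0
  ≡⟨ +-identityʳ _ ⟩
    ∑ (suc n) (λ i → ∑ (suc n) (c i) + c i (suc n))
  ≡⟨ ∑-+ (suc n) (λ i → ∑ (suc n) (c i)) (λ i → c i (suc n)) ⟩
    ∑ (suc n) (λ i → ∑ (suc n) (c i)) + ∑ (suc n) (λ i → c i (suc n))
  ≡⟨ cong₂ _+_ first-block last-column ⟩
    coinvF n F + p + p ∎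
  where
  open ≡-Reasoning
  G = insertPair F p n
  c : ℕ → ℕ → ℕ
  c i j = χ ((i <ᵇ j) ∧ (G i <ᵇ G j))
  Glast = insert-last F p n p≤n
  Gp = insert-at-p F p n p≤n
  Gskip = insert-skip F p n p≤n
  Gskip<sn : ∀ j → j < n → G (skip p j) < suc n
  Gskip<sn j j<n = subst (_< suc n) (sym (Gskip j j<n)) (skip-bound p (proj₁ (I j j<n)))
  last-row : ∑ (suc (suc n)) (c (suc n)) ≡ 0
  last-row = ∑-zero (suc (suc n)) (λ j j<N → cong χ (∧-false₁ (G (suc n) <ᵇ G j) (≤⇒¬<ᵇ (≤-pred j<N))))
  last-column : ∑ (suc n) (λ i → c i (suc n)) ≡ p
  last-column = begin
      ∑ (suc n) (λ i → c i (suc n))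
    ≡⟨ ∑-skip n p (λ i → c i (suc n)) p≤n ⟩
      ∑ n (λ i → c (skip p i) (suc n)) + c p (suc n)
    ≡⟨ cong₂ _+_ (∑-cong n old-entries) p-entry ⟩
      ∑ n (λ i → χ (F i <ᵇ p)) + 0
    ≡⟨ trans (+-identityʳ _) (count-values< n F I p p≤n) ⟩
      p ∎
    where
    old-entries : ∀ i → i < n → c (skip p i) (suc n) ≡ χ (F i <ᵇ p)
    old-entries i i<n = cong χ (trans (∧-true₁ (G (skip p i) <ᵇ G (suc n)) (<⇒<ᵇ (skip-bound p i<n)))
      (trans (cong₂ _<ᵇ_ (Gskip i i<n) Glast) (skip-<ᵇp p (F i))))
    p-entry : c p (suc n) ≡ 0
    p-entry = cong χ (∧-false₂ (p <ᵇ suc n) (subst₂ (λ u v → ¬ T (u <ᵇ v)) (sym Gp) (sym Glast)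
      (≤⇒¬<ᵇ (≤-trans p≤n (n≤1+n n)))))
  first-block : ∑ (suc n) (λ i → ∑ (suc n) (c i)) ≡ coinvF n F + p
  first-block = begin
      ∑ (suc n) (λ i → ∑ (suc n) (c i))
    ≡⟨ ∑-skip n p (λ i → ∑ (suc n) (c i)) p≤n ⟩
      ∑ n (λ i → ∑ (suc n) (c (skip p i))) + ∑ (suc n) (c p)
    ≡⟨ cong₂ _+_ (∑-cong n old-row) p-row ⟩
      ∑ n (λ i → ∑ n (λ j → χ ((i <ᵇ j) ∧ (F i <ᵇ F j))) + χ (i <ᵇ p)) + 0
    ≡⟨ trans (+-identityʳ _) (∑-+ n (λ i → ∑ n (λ j → χ ((i <ᵇ j) ∧ (F i <ᵇ F j)))) (λ i → χ (i <ᵇ p))) ⟩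
      coinvF n F + ∑ n (λ i → χ (i <ᵇ p))
    ≡⟨ cong (coinvF n F +_) (∑-χ< n p p≤n) ⟩
      coinvF n F + p ∎
    where
    p-row : ∑ (suc n) (c p) ≡ 0
    p-row = begin
        ∑ (suc n) (c p)
      ≡⟨ ∑-skip n p (c p) p≤n ⟩
        ∑ n (λ j → c p (skip p j)) + c p p
      ≡⟨ cong₂ _+_ (∑-zero n (λ j j<n → cong χ (∧-false₂ (p <ᵇ skip p j)
             (subst (λ z → ¬ T (z <ᵇ G (skip p j))) (sym Gp) (≤⇒¬<ᵇ (≤-trans (Gskip<sn j j<n) (n≤1+n _)))))))
           (cong χ (∧-false₁ (G p <ᵇ G p) (≤⇒¬<ᵇ {p} {p} ≤-refl))) ⟩
        0 ∎
    old-row : ∀ i → i < n →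
      ∑ (suc n) (c (skip p i)) ≡ ∑ n (λ j → χ ((i <ᵇ j) ∧ (F i <ᵇ F j))) + χ (i <ᵇ p)
    old-row i i<n = begin
        ∑ (suc n) (c (skip p i))
      ≡⟨ ∑-skip n p (c (skip p i)) p≤n ⟩
        ∑ n (λ j → c (skip p i) (skip p j)) + c (skip p i) p
      ≡⟨ cong₂ _+_ (∑-cong n (λ j j<n → cong χ (cong₂ _∧_ (skip-<ᵇ p i j)
             (trans (cong₂ _<ᵇ_ (Gskip i i<n) (Gskip j j<n)) (skip-<ᵇ p (F i) (F j))))))
           (cong χ (trans (∧-true₂ (skip p i <ᵇ p)
              (subst (λ z → T (G (skip p i) <ᵇ z)) (sym Gp) (<⇒<ᵇ (Gskip<sn i i<n))))
             (skip-<ᵇp p i))) ⟩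
        ∑ n (λ j → χ ((i <ᵇ j) ∧ (F i <ᵇ F j))) + χ (i <ᵇ p) ∎

prefixLen : (ℕ → ℕ) → ℕ → ℕ
prefixLen F zero = 0
prefixLen F (suc zero) = 1
prefixLen F (suc (suc m)) = if F 1 ≤ᵇ F 0 then suc (prefixLen (λ i → F (suc i)) (suc m)) else 1

StepAntitoneBelow : (ℕ → ℕ) → ℕ → Set
StepAntitoneBelow F q = ∀ i → suc i < q → F (suc i) ≤ F i

step⇒antitone : ∀ F q → StepAntitoneBelow F q → AntitoneBelow F q
step⇒antitone F q pd i (suc j) (s≤s i≤j) sj<q with m≤n⇒m<n∨m≡n i≤j
... | inj₂ refl = pd i sj<q
... | inj₁ i<j = ≤-trans (pd j sj<q) (step⇒antitone F q pd i j i<j (<-trans (n<1+n j) sj<q))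

antitone⇒step : ∀ F q → AntitoneBelow F q → StepAntitoneBelow F q
antitone⇒step F q nd i lt = nd i (suc i) (n<1+n i) lt

prefixLen≤ : ∀ F m → prefixLen F m ≤ m
prefixLen≤ F zero = z≤n
prefixLen≤ F (suc zero) = ≤-refl
prefixLen≤ F (suc (suc m)) = step (F 1 ≤ᵇ F 0) (prefixLen≤ (λ i → F (suc i)) (suc m))
  where
  step : ∀ b {x} → x ≤ suc m → (if b then suc x else 1) ≤ suc (suc m)
  step true h = s≤s h
  step false h = s≤s z≤n

prefixLen-antitone : ∀ F m q → q ≤ prefixLen F m → StepAntitoneBelow F q
prefixLen-antitone F zero q le i lt with ≤-trans lt le
... | ()
prefixLen-antitone F (suc zero) q le i lt with ≤-trans lt le
... | s≤s ()
prefixLen-antitone F (suc (suc m)) q le i lt with F 1 ≤ᵇ F 0 in eq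
prefixLen-antitone F (suc (suc m)) q le i lt | false with ≤-trans lt le
... | s≤s ()
prefixLen-antitone F (suc (suc m)) q le zero lt | true = ≤ᵇ⇒≤ _ _ (subst T (sym eq) tt)
prefixLen-antitone F (suc (suc m)) (suc q) (s≤s le) (suc i) (s≤s lt) | true =
  prefixLen-antitone (λ i → F (suc i)) (suc m) q le i lt

antitone⇒≤prefixLen : ∀ F m q → q ≤ m → StepAntitoneBelow F q → q ≤ prefixLen F m
antitone⇒≤prefixLen F zero q le pd = le
antitone⇒≤prefixLen F (suc zero) q le pd = le
antitone⇒≤prefixLen F (suc (suc m)) zero le pd = z≤n
antitone⇒≤prefixLen F (suc (suc m)) (suc q) (s≤s le) pd with F 1 ≤ᵇ F 0 in eq
... | true = s≤s (antitone⇒≤prefixLen (λ i → F (suc i)) (suc m) q le (λ i lt → pd (suc i) (s≤s lt)))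
... | false with q
...   | zero = ≤-refl
...   | suc q' = ⊥-elim (subst T eq (≤⇒≤ᵇ (pd 0 (s≤s (s≤s z≤n)))))

prefixLen-unique : ∀ F m L → L ≤ m → StepAntitoneBelow F L →
  (L < m → ¬ StepAntitoneBelow F (suc L)) → prefixLen F m ≡ L
prefixLen-unique F m L le pd no with <-cmp (prefixLen F m) L
... | tri≈ _ e _ = e
... | tri< a _ _ = ⊥-elim (<⇒≱ a (antitone⇒≤prefixLen F m L le pd))
... | tri> _ _ c = ⊥-elim (no (<-≤-trans c (prefixLen≤ F m)) (prefixLen-antitone F m (suc L) c))

prefixLen-cong : ∀ F F' m → (∀ i → i < m → F i ≡ F' i) → prefixLen F m ≡ prefixLen F' m
prefixLen-cong F F' zero e = refl
prefixLen-cong F F' (suc zero) e = refl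
prefixLen-cong F F' (suc (suc m)) e = cong₂ (λ b x → if b then suc x else 1)
  (cong₂ _≤ᵇ_ (e 1 (s≤s (s≤s z≤n))) (e 0 z<s))
  (prefixLen-cong (λ i → F (suc i)) (F' ∘′ suc) (suc m) (λ i lt → e (suc i) (s≤s lt)))

-- The update rule for the prefix length after inserting at slot p, where
-- full records whether the old prefix was the whole of [0, n).
nextPrefix : ℕ → Bool → ℕ → ℕ
nextPrefix L full zero = if full then suc (suc L) else suc L
nextPrefix L full (suc p) = suc p

module _ (F : ℕ → ℕ) (n : ℕ) (bound : ∀ i → i < n → F i < n) where

  -- For 0 < p ≤ L(F) the new prefix has length exactly p: it is the old
  -- prefix up to p, and the new entry n+1 at position p starts an ascent.
  prefixLen-insert-suc : ∀ p → suc p ≤ prefixLen F n → prefixLen (insertPair F (suc p) n) (suc (suc n)) ≡ suc p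
  prefixLen-insert-suc p le =
    prefixLen-unique G (suc (suc n)) (suc p) (≤-trans sp≤n (≤-trans (n≤1+n n) (n≤1+n _))) antitone ascent
    where
    sp≤n = ≤-trans le (prefixLen≤ F n)
    G = insertPair F (suc p) n
    G-below : ∀ i → i < suc p → G i ≡ skip (suc p) (F i)
    G-below i lt = trans (cong G (sym (skip-lt lt))) (insert-skip F (suc p) n sp≤n i (<-≤-trans lt sp≤n))
    antitone : StepAntitoneBelow G (suc p)
    antitone i lt = subst₂ _≤_ (sym (G-below (suc i) lt)) (sym (G-below i (<-trans (n<1+n i) lt)))
      (skip-mono≤ (suc p) (prefixLen-antitone F n (suc p) le i lt))
    ascent : _ → ¬ StepAntitoneBelow G (suc (suc p))
    ascent _ h = <⇒≱ (subst (_< suc n) (sym (G-below p (n<1+n p))) (skip-bound (suc p) (bound p p<n)))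
      (subst (_≤ G p) (insert-at-p F (suc p) n sp≤n) (h p ≤-refl))
      where p<n = <-≤-trans (n<1+n p) sp≤n

  private
    G = insertPair F 0 n
    G0 : G 0 ≡ suc n
    G0 = insert-at-p F 0 n z≤n
    Gs : ∀ i → i < n → G (suc i) ≡ suc (F i)
    Gs i i<n = insert-skip F 0 n z≤n i i<n

  -- For p = 0, G = (n+1, F(0)+1, …, F(n-1)+1, 0): the prefixes of G and F correspond.
  antitone-shift⇒ : ∀ q → q ≤ n → StepAntitoneBelow G (suc q) → StepAntitoneBelow F q
  antitone-shift⇒ q q≤n h i lt = ≤-pred (subst₂ _≤_ (Gs (suc i) (<-≤-trans lt q≤n))
    (Gs i (<-trans (n<1+n i) (<-≤-trans lt q≤n))) (h (suc i) (s≤s lt)))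

  antitone-shift⇐ : ∀ q → q ≤ n → StepAntitoneBelow F q → StepAntitoneBelow G (suc q)
  antitone-shift⇐ q q≤n h zero (s≤s lt) =
    subst₂ _≤_ (sym (Gs 0 0<n)) (sym G0) (≤-trans (bound 0 0<n) (n≤1+n n))
    where 0<n = <-≤-trans lt q≤n
  antitone-shift⇐ q q≤n h (suc i) (s≤s lt) = subst₂ _≤_ (sym (Gs (suc i) (<-≤-trans lt q≤n)))
    (sym (Gs i (<-trans (n<1+n i) (<-≤-trans lt q≤n)))) (s≤s (h i lt))

  -- If F is entirely non-increasing then so is G, whose last value 0 is its minimum.
  prefixLen-insert-0-full : prefixLen F n ≡ n → prefixLen G (suc (suc n)) ≡ suc (suc n)
  prefixLen-insert-0-full e =
    prefixLen-unique G (suc (suc n)) (suc (suc n)) ≤-refl antitone (λ x → ⊥-elim (<-irrefl refl x))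
    where
    antitone : StepAntitoneBelow G (suc (suc n))
    antitone i (s≤s lt) with m≤n⇒m<n∨m≡n lt
    ... | inj₁ lt' = antitone-shift⇐ n ≤-refl (prefixLen-antitone F n n (≤-reflexive (sym e))) i lt'
    ... | inj₂ refl = subst (_≤ G i) (sym (insert-last F 0 n z≤n)) z≤n

  prefixLen-insert-0-partial : prefixLen F n < n → prefixLen G (suc (suc n)) ≡ suc (prefixLen F n)
  prefixLen-insert-0-partial lt = prefixLen-unique G (suc (suc n)) (suc L) (≤-trans (s≤s (prefixLen≤ F n)) (n≤1+n _))
    (antitone-shift⇐ L (prefixLen≤ F n) (prefixLen-antitone F n L ≤-refl))
    (λ _ h → <-irrefl refl (antitone⇒≤prefixLen F n (suc L) lt (antitone-shift⇒ (suc L) lt h)))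
    where L = prefixLen F n

  prefixLen-insert : ∀ p → p ≤ prefixLen F n →
    prefixLen (insertPair F p n) (suc (suc n)) ≡ nextPrefix (prefixLen F n) (prefixLen F n ≡ᵇ n) p
  prefixLen-insert (suc p) le = prefixLen-insert-suc p le
  prefixLen-insert zero _ with prefixLen F n ≡ᵇ n in eq
  ... | true = trans (prefixLen-insert-0-full e) (cong (λ z → suc (suc z)) (sym e))
    where e = ≡ᵇ⇒≡ _ _ (subst T (sym eq) tt)
  ... | false = prefixLen-insert-0-partial (≤∧≢⇒< (prefixLen≤ F n) (λ e → subst T eq (≡⇒≡ᵇ _ _ e)))

-- §3  From the vectors of Defs to functions ℕ → ℕ.

-- The values of a vector, as a function on ℕ (0 outside the range).
⟦_⟧ : ∀ {n m} → Vec (Fin n) m → ℕ → ℕ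
⟦ [] ⟧ i = 0
⟦ x ∷ xs ⟧ zero = toℕ x
⟦ x ∷ xs ⟧ (suc i) = ⟦ xs ⟧ i

lookup-⟦⟧ : ∀ {n m} (ι : Vec (Fin n) m) (i : Fin m) → toℕ (lookup ι i) ≡ ⟦ ι ⟧ (toℕ i)
lookup-⟦⟧ (x ∷ ι) fzero = refl
lookup-⟦⟧ (x ∷ ι) (fsuc i) = lookup-⟦⟧ ι i

⟦⟧-bound : ∀ {n m} (ι : Vec (Fin n) m) i → i < m → ⟦ ι ⟧ i < n
⟦⟧-bound (x ∷ ι) zero _ = toℕ<n x
⟦⟧-bound (x ∷ ι) (suc i) (s≤s lt) = ⟦⟧-bound ι i lt

⟦⟧-injective : ∀ {n m} (u v : Vec (Fin n) m) → (∀ i → i < m → ⟦ u ⟧ i ≡ ⟦ v ⟧ i) → u ≡ v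
⟦⟧-injective [] [] e = refl
⟦⟧-injective (x ∷ u) (y ∷ v) e =
  cong₂ _∷_ (toℕ-injective (e 0 z<s)) (⟦⟧-injective u v (λ i lt → e (suc i) (s≤s lt)))

-- v as an element of Fin (suc m), truncated at m.
clamp : (m v : ℕ) → Fin (suc m)
clamp zero _ = fzero
clamp (suc m) zero = fzero
clamp (suc m) (suc v) = fsuc (clamp m v)

toℕ-clamp : ∀ m v → v ≤ m → toℕ (clamp m v) ≡ v
toℕ-clamp zero zero _ = refl
toℕ-clamp (suc m) zero _ = refl
toℕ-clamp (suc m) (suc v) (s≤s le) = cong suc (toℕ-clamp m v le)

tabulateℕ : ∀ n m → (ℕ → ℕ) → Vec (Fin (suc n)) m
tabulateℕ n zero H = []
tabulateℕ n (suc m) H = clamp n (H 0) ∷ tabulateℕ n m (λ i → H (suc i))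

⟦tabulateℕ⟧ : ∀ n m H i → i < m → H i < suc n → ⟦ tabulateℕ n m H ⟧ i ≡ H i
⟦tabulateℕ⟧ n (suc m) H zero _ b = toℕ-clamp n (H 0) (≤-pred b)
⟦tabulateℕ⟧ n (suc m) H (suc i) (s≤s lt) b = ⟦tabulateℕ⟧ n m (λ i → H (suc i)) i lt b

toVec : ∀ n → (ℕ → ℕ) → Vec (Fin n) n
toVec zero H = []
toVec (suc n) H = tabulateℕ n (suc n) H

⟦toVec⟧ : ∀ n H → (∀ i → i < n → H i < n) → ∀ i → i < n → ⟦ toVec n H ⟧ i ≡ H i
⟦toVec⟧ (suc n) H b i lt = ⟦tabulateℕ⟧ n (suc n) H i lt (b i lt)

module _ {n : ℕ} (ι : Vec (Fin n) n) where
  private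
    F = ⟦ ι ⟧
    lk : ∀ (i : Fin n) → toℕ (lookup ι i) ≡ F (toℕ i)
    lk = lookup-⟦⟧ ι
    lk² : ∀ (i : Fin n) → toℕ (lookup ι (lookup ι i)) ≡ F (F (toℕ i))
    lk² i = trans (lk (lookup ι i)) (cong F (lk i))
    involutive moved fpf : Fin n → Bool
    involutive i = ⌊ ι ⟨ ι ⟨ i ⟩ ⟩ ≟ i ⌋
    moved i = not ⌊ ι ⟨ i ⟩ ≟ i ⌋
    fpf i = involutive i ∧ moved i
    pattern123 : Fin n → Fin n → Fin n → Bool
    pattern123 i j l = (i <ꟳ j) ∧ (j <ꟳ l) ∧ (ι ⟨ i ⟩ <ꟳ ι ⟨ j ⟩) ∧ (ι ⟨ j ⟩ <ꟳ ι ⟨ l ⟩)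

  fpf⇒IsFPInv : T (isFPFInvolution ι) → IsFPInv n F
  fpf⇒IsFPInv h i lt = ⟦⟧-bound ι i lt , FFi , Fi≢i
    where
    fi = fromℕ< lt
    ti : toℕ fi ≡ i
    ti = toℕ-fromℕ< lt
    t : T (fpf fi)
    t = tabulate⁻ (all⁺ fpf (allFin n) h) fi
    FFi : F (F i) ≡ i
    FFi = trans (sym (subst (λ z → toℕ (lookup ι (lookup ι fi)) ≡ F (F z)) ti (lk² fi)))
      (trans (cong toℕ (toWitness (T-∧₁ (involutive fi) (moved fi) t))) ti)
    Fi≢i : F i ≢ i
    Fi≢i e = T-not (T-∧₂ (involutive fi) (moved fi) t) (fromWitness (toℕ-injective (trans (trans (lk fi) (cong F ti)) (trans e (sym ti)))))

  IsFPInv⇒fpf : IsFPInv n F → T (isFPFInvolution ι)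
  IsFPInv⇒fpf I = all⁻ fpf (tabulate⁺ λ fi → ∧-intro (involutive fi) (moved fi)
    (fromWitness (toℕ-injective (trans (lk² fi) (proj₁ (proj₂ (I (toℕ fi) (toℕ<n fi)))))))
    (not-T (λ t → proj₂ (proj₂ (I (toℕ fi) (toℕ<n fi))) (trans (sym (lk fi)) (cong toℕ (toWitness t))))))

  contains⇒Has123 : T (contains123 ι) → Has123 n F
  contains⇒Has123 h with satisfied (any⁻ _ (allFin n) h)
  ... | i , hi with satisfied (any⁻ _ (allFin n) hi)
  ... | j , hj with satisfied (any⁻ (pattern123 i j) (allFin n) hj)
  ... | l , hl = toℕ i , toℕ j , toℕ l , <ᵇ⇒< _ _ (T-∧₁ a (b ∧ c ∧ d) hl) , <ᵇ⇒< _ _ (T-∧₁ b (c ∧ d) h₂) , toℕ<n l ,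
      subst₂ _<_ (lk i) (lk j) (<ᵇ⇒< _ _ (T-∧₁ c d h₃)) ,
      subst₂ _<_ (lk j) (lk l) (<ᵇ⇒< _ _ (T-∧₂ c d h₃))
    where
    a = i <ꟳ j
    b = j <ꟳ l
    c = ι ⟨ i ⟩ <ꟳ ι ⟨ j ⟩
    d = ι ⟨ j ⟩ <ꟳ ι ⟨ l ⟩
    h₂ = T-∧₂ a (b ∧ c ∧ d) hl
    h₃ = T-∧₂ b (c ∧ d) h₂

  Has123⇒contains : Has123 n F → T (contains123 ι)
  Has123⇒contains (i , j , l , i<j , j<l , l<n , a , b) =
    any⁺ _ (lose (∈-allFin fi) (any⁺ _ (lose (∈-allFin fj) (any⁺ (pattern123 fi fj) (lose (∈-allFin fl)
      (∧-intro (fi <ꟳ fj) _ (<⇒<ᵇ (subst₂ _<_ (sym ei) (sym ej) i<j))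
      (∧-intro (fj <ꟳ fl) _ (<⇒<ᵇ (subst₂ _<_ (sym ej) (sym el) j<l))
      (∧-intro (ι ⟨ fi ⟩ <ꟳ ι ⟨ fj ⟩) _ (<⇒<ᵇ (subst₂ _<_ (sym (value fi ei)) (sym (value fj ej)) a))
        (<⇒<ᵇ (subst₂ _<_ (sym (value fj ej)) (sym (value fl el)) b))))))))))
    where
    j<n = <-trans j<l l<n
    i<n = <-trans i<j j<n
    fi = fromℕ< i<n
    fj = fromℕ< j<n
    fl = fromℕ< l<n
    ei = toℕ-fromℕ< i<n
    ej = toℕ-fromℕ< j<n
    el = toℕ-fromℕ< l<n
    value : ∀ (x : Fin n) {y} → toℕ x ≡ y → toℕ (lookup ι x) ≡ F y
    value x e = trans (lk x) (cong F e)

  inFI123⇒IsFI123 : T (inFI123 ι) → IsFI123 n F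
  inFI123⇒IsFI123 t = fpf⇒IsFPInv (T-∧₁ _ (not (contains123 ι)) t) ,
    λ h → T-not (T-∧₂ (isFPFInvolution ι) _ t) (Has123⇒contains h)

  IsFI123⇒inFI123 : IsFI123 n F → T (inFI123 ι)
  IsFI123⇒inFI123 (I , avoids) = ∧-intro _ _ (IsFPInv⇒fpf I) (not-T (λ t → avoids (contains⇒Has123 t)))

∑-tabulate : ∀ {m} (f : Fin m → ℕ) (h : ℕ → ℕ) → (∀ i → f i ≡ h (toℕ i)) → sum (tabulate f) ≡ ∑ m h
∑-tabulate {zero} f h e = refl
∑-tabulate {suc m} f h e = cong₂ _+_ (e fzero) (∑-tabulate (λ i → f (fsuc i)) (λ i → h (suc i)) (λ i → e (fsuc i)))

length-filter-tabulate : ∀ {A : Set} {m} (b : A → Bool) (g : Fin m → A) (h : ℕ → ℕ) →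
  (∀ i → χ (b (g i)) ≡ h (toℕ i)) → length (filter (λ x → T? (b x)) (tabulate g)) ≡ ∑ m h
length-filter-tabulate {m = zero} b g h e = refl
length-filter-tabulate {m = suc m} b g h e with b (g fzero) | e fzero
... | true | e0 = cong₂ _+_ e0 (length-filter-tabulate b (g ∘′ fsuc) (h ∘′ suc) (λ i → e (fsuc i)))
... | false | e0 = trans (length-filter-tabulate b (g ∘′ fsuc) (h ∘′ suc) (λ i → e (fsuc i)))
  (cong (_+ ∑ m (h ∘′ suc)) e0)

coinv≡coinvF : ∀ {n} (ι : Vec (Fin n) n) → coinv ι ≡ coinvF n ⟦ ι ⟧
coinv≡coinvF {n} ι = trans (cong sum (map-tabulate (λ x → x) count))
  (∑-tabulate _ _ (λ i → length-filter-tabulate _ (λ x → x) _ (λ j → cong χ (cong₂ _∧_ refl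
    (cong₂ _<ᵇ_ (lookup-⟦⟧ ι i) (lookup-⟦⟧ ι j))))))
  where
  count : Fin n → ℕ
  count i = length (filter (λ j → T? ((i <ꟳ j) ∧ (ι ⟨ i ⟩ <ꟳ ι ⟨ j ⟩))) (allFin n))

-- §4  The growth rule for FI_n(123).

Σ-T-≡ : ∀ {A : Set} {P : A → Bool} {x y : A} {s : T (P x)} {t : T (P y)} →
  x ≡ y → _≡_ {A = Σ A (λ a → T (P a))} (x , s) (y , t)
Σ-T-≡ {s = s} {t} refl = cong (_ ,_) (T-irrelevant s t)

Upto : ℕ → Set
Upto L = Σ ℕ (λ p → T (p ≤ᵇ L))

Slots : (A : Set) → (A → ℕ) → Set
Slots A L = Σ A (λ a → Upto (L a))

Slots-≡ : ∀ {A : Set} {L : A → ℕ} {a a' : A} {p p' : ℕ} {t : T (p ≤ᵇ L a)} {t' : T (p' ≤ᵇ L a')} →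
  a ≡ a' → p ≡ p' → _≡_ {A = Slots A L} (a , p , t) (a' , p' , t')
Slots-≡ {t = t} {t'} refl refl = cong (λ z → _ , _ , z) (T-irrelevant t t')

Upto-cong : ∀ {L L'} → L ≡ L' → Upto L ↔ Upto L'
Upto-cong e = mk↔ₛ′ (λ (p , t) → p , subst (λ z → T (p ≤ᵇ z)) e t)
  (λ (p , t) → p , subst (λ z → T (p ≤ᵇ z)) (sym e) t)
  (λ _ → Σ-T-≡ refl) (λ _ → Σ-T-≡ refl)

IsFI123-cong : ∀ n F F' → (∀ i → i < n → F i ≡ F' i) → IsFI123 n F → IsFI123 n F'
IsFI123-cong n F F' e (I , avoids) = I' , avoids'
  where
  I' : IsFPInv n F'
  I' i lt with I i lt
  ... | b , ff , fp = subst (_< n) (e i lt) b ,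
        trans (sym (trans (e (F i) b) (cong F' (e i lt)))) ff ,
        λ q → fp (trans (e i lt) q)
  avoids' : ¬ Has123 n F'
  avoids' (i , j , l , a , b , c , d , f) = avoids (i , j , l , a , b , c ,
        subst₂ _<_ (sym (e i (<-trans a (<-trans b c)))) (sym (e j (<-trans b c))) d ,
        subst₂ _<_ (sym (e j (<-trans b c))) (sym (e l c)) f)

coinvF-cong : ∀ m F F' → (∀ i → i < m → F i ≡ F' i) → coinvF m F ≡ coinvF m F'
coinvF-cong m F F' e = ∑-cong m (λ i i<m → ∑-cong m (λ j j<m → cong (λ z → χ ((i <ᵇ j) ∧ z))
  (cong₂ _<ᵇ_ (e i i<m) (e j j<m))))

insertPair-cong : ∀ F F' p n → p ≤ n → (∀ i → i < n → F i ≡ F' i) →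
  ∀ j → j < suc (suc n) → insertPair F p n j ≡ insertPair F' p n j
insertPair-cong F F' p n p≤n e j lt with insert-view F p n p≤n j lt
... | inj₁ refl = trans (insert-last F p n p≤n) (sym (insert-last F' p n p≤n))
... | inj₂ (inj₁ refl) = trans (insert-at-p F p n p≤n) (sym (insert-at-p F' p n p≤n))
... | inj₂ (inj₂ (i , i<n , refl)) = trans (insert-skip F p n p≤n i i<n)
  (trans (cong (skip p) (e i i<n)) (sym (insert-skip F' p n p≤n i i<n)))

insertPair-bound : ∀ F p n → p ≤ n → (∀ i → i < n → F i < n) →
  ∀ j → j < suc (suc n) → insertPair F p n j < suc (suc n)
insertPair-bound F p n p≤n b j lt with insert-view F p n p≤n j lt
... | inj₁ refl = subst (_< _) (sym (insert-last F p n p≤n)) (≤-trans (s≤s p≤n) (n≤1+n _))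
... | inj₂ (inj₁ refl) = subst (_< _) (sym (insert-at-p F p n p≤n)) ≤-refl
... | inj₂ (inj₂ (i , i<n , refl)) = subst (_< _) (sym (insert-skip F p n p≤n i i<n))
  (≤-trans (skip-bound p (b i i<n)) (n≤1+n _))

removeLastPair-cong : ∀ G G' n → (∀ j → j < suc (suc n) → G j ≡ G' j) →
  ∀ i → i < n → removeLastPair G n i ≡ removeLastPair G' n i
removeLastPair-cong G G' n e i lt = cong₂ unskip e-last (trans (cong G (cong (λ q → skip q i) e-last))
  (e (skip (G' (suc n)) i) (≤-trans (skip-bound (G' (suc n)) lt) (n≤1+n _))))
  where e-last = e (suc n) ≤-refl

FI : ℕ → Set
FI n = Σ (Vec (Fin n) n) (λ ι → T (inFI123 ι))

prefixFI : ∀ {n} → FI n → ℕ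
prefixFI {n} x = prefixLen ⟦ proj₁ x ⟧ n

coinvFI : ∀ {n} → FI n → ℕ
coinvFI x = coinv (proj₁ x)

module _ {n : ℕ} where

  insertFI : Slots (FI n) prefixFI → FI (suc (suc n))
  insertFI ((ι , t) , p , tp) = toVec (suc (suc n)) G ,
    IsFI123⇒inFI123 (toVec (suc (suc n)) G) (IsFI123-cong _ _ _ ⟦insert⟧ valid)
    where
    F = ⟦ ι ⟧
    p≤L = ≤ᵇ⇒≤ p (prefixLen F n) tp
    p≤n = ≤-trans p≤L (prefixLen≤ F n)
    G = insertPair F p n
    valid : IsFI123 (suc (suc n)) G
    valid = insert-valid F p n p≤n (inFI123⇒IsFI123 ι t)
      (step⇒antitone F p (prefixLen-antitone F n p p≤L))
    ⟦insert⟧ : ∀ j → j < suc (suc n) → G j ≡ ⟦ toVec (suc (suc n)) G ⟧ j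
    ⟦insert⟧ j lt = sym (⟦toVec⟧ (suc (suc n)) G (insertPair-bound F p n p≤n (⟦⟧-bound ι)) j lt)

  ⟦insertFI⟧ : ∀ s → ∀ j → j < suc (suc n) →
    ⟦ proj₁ (insertFI s) ⟧ j ≡ insertPair ⟦ proj₁ (proj₁ s) ⟧ (proj₁ (proj₂ s)) n j
  ⟦insertFI⟧ ((ι , t) , p , tp) = ⟦toVec⟧ (suc (suc n)) (insertPair ⟦ ι ⟧ p n)
    (insertPair-bound ⟦ ι ⟧ p n (≤-trans (≤ᵇ⇒≤ p _ tp) (prefixLen≤ ⟦ ι ⟧ n)) (⟦⟧-bound ι))

  removeFI : FI (suc (suc n)) → Slots (FI n) prefixFI
  removeFI (τ , t) = (toVec n F , IsFI123⇒inFI123 (toVec n F) (IsFI123-cong _ _ _ ⟦remove⟧ (remove-valid G n V))) ,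
    p , ≤⇒≤ᵇ (subst (p ≤_) (prefixLen-cong _ _ n ⟦remove⟧)
      (antitone⇒≤prefixLen F n p (last-partner≤ G n V) (antitone⇒step F p (remove-antitone G n V))))
    where
    G = ⟦ τ ⟧
    V = inFI123⇒IsFI123 τ t
    p = G (suc n)
    F = removeLastPair G n
    ⟦remove⟧ : ∀ i → i < n → F i ≡ ⟦ toVec n F ⟧ i
    ⟦remove⟧ i lt = sym (⟦toVec⟧ n F (λ i lt → proj₁ (remove-inv G n V i lt)) i lt)

  ⟦removeFI⟧ : ∀ x → ∀ i → i < n → ⟦ proj₁ (proj₁ (removeFI x)) ⟧ i ≡ removeLastPair ⟦ proj₁ x ⟧ n i
  ⟦removeFI⟧ (τ , t) = ⟦toVec⟧ n (removeLastPair ⟦ τ ⟧ n)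
    (λ i lt → proj₁ (remove-inv ⟦ τ ⟧ n (inFI123⇒IsFI123 τ t) i lt))

  growFI : FI (suc (suc n)) ↔ Slots (FI n) prefixFI
  growFI = mk↔ₛ′ removeFI insertFI remove∘insert insert∘remove
    where
    remove∘insert : ∀ s → removeFI (insertFI s) ≡ s
    remove∘insert s@((ι , t) , p , tp) = Slots-≡ (Σ-T-≡ (⟦⟧-injective _ _ same-values)) last-value
      where
      p≤n = ≤-trans (≤ᵇ⇒≤ p _ tp) (prefixLen≤ ⟦ ι ⟧ n)
      same-values : ∀ i → i < n → ⟦ proj₁ (proj₁ (removeFI (insertFI s))) ⟧ i ≡ ⟦ ι ⟧ i
      same-values i lt = trans (⟦removeFI⟧ (insertFI s) i lt)
        (trans (removeLastPair-cong _ _ n (⟦insertFI⟧ s) i lt) (remove-insert ⟦ ι ⟧ p n p≤n i lt))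
      last-value : ⟦ proj₁ (insertFI s) ⟧ (suc n) ≡ p
      last-value = trans (⟦insertFI⟧ s (suc n) ≤-refl) (insert-last ⟦ ι ⟧ p n p≤n)
    insert∘remove : ∀ x → insertFI (removeFI x) ≡ x
    insert∘remove x@(τ , t) = Σ-T-≡ (⟦⟧-injective _ _ same-values)
      where
      V = inFI123⇒IsFI123 τ t
      p≤n = last-partner≤ ⟦ τ ⟧ n V
      same-values : ∀ j → j < suc (suc n) → ⟦ proj₁ (insertFI (removeFI x)) ⟧ j ≡ ⟦ τ ⟧ j
      same-values j lt = trans (⟦insertFI⟧ (removeFI x) j lt)
        (trans (insertPair-cong _ _ _ n p≤n (⟦removeFI⟧ x) j lt) (insert-remove ⟦ τ ⟧ n V j lt))

  coinv-insertFI : ∀ s → coinvFI (insertFI s) ≡ coinvFI (proj₁ s) + proj₁ (proj₂ s) + proj₁ (proj₂ s)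
  coinv-insertFI s@((ι , t) , p , tp) = begin
      coinv (proj₁ (insertFI s))
    ≡⟨ coinv≡coinvF (proj₁ (insertFI s)) ⟩
      coinvF (suc (suc n)) ⟦ proj₁ (insertFI s) ⟧
    ≡⟨ coinvF-cong _ _ _ (⟦insertFI⟧ s) ⟩
      coinvF (suc (suc n)) (insertPair ⟦ ι ⟧ p n)
    ≡⟨ coinv-insert n ⟦ ι ⟧ p (proj₁ (inFI123⇒IsFI123 ι t)) (≤-trans (≤ᵇ⇒≤ p _ tp) (prefixLen≤ ⟦ ι ⟧ n)) ⟩
      coinvF n ⟦ ι ⟧ + p + p
    ≡⟨ cong (λ z → z + p + p) (sym (coinv≡coinvF ι)) ⟩
      coinv ι + p + p ∎
    where open ≡-Reasoning

  prefix-insertFI : ∀ s → prefixFI (insertFI s) ≡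
    nextPrefix (prefixFI (proj₁ s)) (prefixFI (proj₁ s) ≡ᵇ n) (proj₁ (proj₂ s))
  prefix-insertFI s@((ι , t) , p , tp) = trans (prefixLen-cong _ _ (suc (suc n)) (⟦insertFI⟧ s))
    (prefixLen-insert ⟦ ι ⟧ n (λ i lt → proj₁ (proj₁ (inFI123⇒IsFI123 ι t) i lt)) p (≤ᵇ⇒≤ p _ tp))

full-insertFI : ∀ {n} (s : Slots (FI n) prefixFI) →
  (prefixFI (insertFI s) ≡ᵇ suc (suc n)) ≡ (prefixFI (proj₁ s) ≡ᵇ n) ∧ (proj₁ (proj₂ s) ≡ᵇ 0)
full-insertFI {n} s@(x , p , tp) rewrite prefix-insertFI s = flag (prefixFI x) p (prefixLen≤ _ n) (≤ᵇ⇒≤ p _ tp)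
  where
  ¬T⇒false : ∀ {b} → ¬ T b → b ≡ false
  ¬T⇒false {false} _ = refl
  ¬T⇒false {true} h = ⊥-elim (h tt)
  flag : ∀ L p → L ≤ n → p ≤ L → (nextPrefix L (L ≡ᵇ n) p ≡ᵇ suc (suc n)) ≡ (L ≡ᵇ n) ∧ (p ≡ᵇ 0)
  flag L (suc p) L≤n p≤L = trans (¬T⇒false (λ t → <-irrefl (≡ᵇ⇒≡ _ _ t) (≤-trans (≤-trans p≤L L≤n) (n≤1+n n))))
    (sym (∧-false₂ (L ≡ᵇ n) (λ ())))
  flag L zero L≤n p≤L with L ≡ᵇ n in eq
  ... | true = eq
  ... | false = ¬T⇒false (λ t → <-irrefl (≡ᵇ⇒≡ L (suc n) t) (s≤s L≤n))

-- §5  The growth rule for reversed B-sequences.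
--
-- A sequence (a₁, …, a_ℓ) is stored reversed, as the list a_ℓ ∷ … ∷ a₁ ∷ [],
-- so that the growth step (appending a new last entry) is a cons.

-- The bound 2j+3 of the j-th summand (j counted from 0).
bound : ℕ → ℕ
bound j = 2 * suc j + 1

nextBound : ℕ → List ℕ → ℕ
nextBound b [] = b
nextBound b (x ∷ r) = if x ≡ᵇ 1 then suc (nextBound b r) else x

validRev : ℕ → List ℕ → Bool
validRev b [] = true
validRev b (x ∷ r) = validRev b r ∧ ((1 ≤ᵇ x) ∧ (x ≤ᵇ nextBound b r))

-- The first entry of the sequence (the last of the list) is not 1.
firstNot1 : List ℕ → Bool
firstNot1 [] = true
firstNot1 (x ∷ []) = not (x ≡ᵇ 1)
firstNot1 (x ∷ y ∷ r) = firstNot1 (y ∷ r)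

firstNot1-tail : ∀ y r → T (firstNot1 (y ∷ r)) → T (firstNot1 r)
firstNot1-tail y [] _ = tt
firstNot1-tail y (z ∷ r) t = t

inBRev : ℕ → List ℕ → Bool
inBRev b r = validRev b r ∧ firstNot1 r

weightL : List ℕ → ℕ
weightL [] = 0
weightL (x ∷ r) = pred x + weightL r

isSeq : ℕ → ℕ → List ℕ → Bool
isSeq k j r = (length r + j ≡ᵇ k) ∧ inBRev (bound j) r

Seq : ℕ → Set
Seq k = Σ ℕ (λ j → Σ (List ℕ) (λ r → T (isSeq k j r)))

Seq-≡ : ∀ {k} {j j' : ℕ} {r r' : List ℕ} {t t'} → j ≡ j' → r ≡ r' → _≡_ {A = Seq k} (j , r , t) (j' , r' , t')
Seq-≡ {t = t} {t'} refl refl = cong (λ z → _ , _ , z) (T-irrelevant t t')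

-- The statistics matching prefixFI, "entirely non-increasing" and coinv.
prefixSeq : ∀ {k} → Seq k → ℕ
prefixSeq (j , r , _) = pred (nextBound (bound j) r)

emptySeq : ∀ {k} → Seq k → Bool
emptySeq (j , r , _) = null r

weightSeq : ∀ {k} → Seq k → ℕ
weightSeq (j , r , _) = 2 * weightL r

nextBound-pos : ∀ b r → 1 ≤ b → T (validRev b r) → 1 ≤ nextBound b r
nextBound-pos b [] h _ = h
nextBound-pos b (x ∷ r) h t with x ≡ᵇ 1
... | true = s≤s z≤n
... | false = ≤ᵇ⇒≤ 1 x (T-∧₁ (1 ≤ᵇ x) (x ≤ᵇ nextBound b r) (T-∧₂ (validRev b r) _ t))

double-+ : ∀ p w → 2 * (p + w) ≡ 2 * w + p + p
double-+ p w = trans (*-distribˡ-+ 2 p w) (trans (+-comm (2 * p) (2 * w))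
  (trans (cong (2 * w +_) (cong (p +_) (+-identityʳ p))) (sym (+-assoc (2 * w) p p))))

module _ {k : ℕ} where

  -- Slot p of (j , r) appends the entry p+1; on the empty sequence, slot 0
  -- instead passes to the next summand j+1 (an empty sequence there).
  appendSeq : Slots (Seq k) prefixSeq → Seq (suc k)
  appendSeq ((j , [] , t) , zero , tp) = suc j , [] , t
  appendSeq ((j , [] , t) , suc p , tp) = j , suc (suc p) ∷ [] ,
    ∧-intro (suc j ≡ᵇ suc k) _ (T-∧₁ (j ≡ᵇ k) _ t) (∧-intro _ true (∧-intro true _ tt (∧-intro true _ tt tp)) tt)
  appendSeq ((j , x ∷ r , t) , p , tp) = j , suc p ∷ x ∷ r ,
    ∧-intro (suc (suc (length r)) + j ≡ᵇ suc k) _ (T-∧₁ (suc (length r) + j ≡ᵇ k) _ t)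
      (∧-intro _ (firstNot1 (x ∷ r)) (∧-intro (validRev b (x ∷ r)) _ v (∧-intro true _ tt lt))
        (T-∧₂ (validRev b (x ∷ r)) _ tv))
    where
    b = bound j
    tv = T-∧₂ (suc (length r) + j ≡ᵇ k) _ t
    v = T-∧₁ (validRev b (x ∷ r)) (firstNot1 (x ∷ r)) tv
    lt : T (p <ᵇ nextBound b (x ∷ r))
    lt = <⇒<ᵇ (subst (p <_) (suc-pred (nextBound b (x ∷ r)) {{ >-nonZero (nextBound-pos b (x ∷ r) z<s v) }})
      (s≤s (≤ᵇ⇒≤ p _ tp)))

  unappendSeq : Seq (suc k) → Slots (Seq k) prefixSeq
  unappendSeq (j , y ∷ r , t) = (j , r , ∧-intro (length r + j ≡ᵇ k) _ t₁ (∧-intro (validRev b r) _ v (firstNot1-tail y r f))) ,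
    pred y , ≤⇒≤ᵇ (pred-mono-≤ (≤ᵇ⇒≤ y _ (T-∧₂ (1 ≤ᵇ y) _ (T-∧₂ (validRev b r) _ v'))))
    where
    b = bound j
    t₁ = T-∧₁ (length r + j ≡ᵇ k) _ t
    tv = T-∧₂ (suc (length r) + j ≡ᵇ suc k) _ t
    v' = T-∧₁ (validRev b (y ∷ r)) _ tv
    v = T-∧₁ (validRev b r) _ v'
    f = T-∧₂ (validRev b (y ∷ r)) _ tv
  unappendSeq (zero , [] , ())
  unappendSeq (suc j , [] , t) = (j , [] , t) , 0 , tt

  growSeq : Seq (suc k) ↔ Slots (Seq k) prefixSeq
  growSeq = mk↔ₛ′ unappendSeq appendSeq unappend∘append append∘unappend
    where
    unappend∘append : ∀ s → unappendSeq (appendSeq s) ≡ s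
    unappend∘append ((j , [] , t) , zero , tp) = refl
    unappend∘append ((j , [] , t) , suc p , tp) = Slots-≡ (Seq-≡ refl refl) refl
    unappend∘append ((j , x ∷ r , t) , p , tp) = Slots-≡ (Seq-≡ refl refl) refl
    -- Entries 0 are excluded, and a one-entry sequence (1) is not in B.
    append∘unappend : ∀ z → appendSeq (unappendSeq z) ≡ z
    append∘unappend (j , zero ∷ r , t) = ⊥-elim (T-∧₁ (1 ≤ᵇ 0) (0 ≤ᵇ nextBound (bound j) r) (T-∧₂ (validRev (bound j) r) _
      (T-∧₁ (validRev (bound j) (0 ∷ r)) _ (T-∧₂ (suc (length r) + j ≡ᵇ suc k) _ t))))
    append∘unappend (j , suc zero ∷ [] , t) = ⊥-elim (T-∧₂ (validRev (bound j) (1 ∷ [])) false (T-∧₂ (suc j ≡ᵇ suc k) _ t))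
    append∘unappend (j , suc (suc y) ∷ [] , t) = Seq-≡ refl refl
    append∘unappend (j , suc y ∷ x ∷ r , t) = Seq-≡ refl refl
    append∘unappend (zero , [] , ())
    append∘unappend (suc j , [] , t) = refl

  prefix-appendSeq : ∀ s → prefixSeq (appendSeq s) ≡ nextPrefix (prefixSeq (proj₁ s)) (emptySeq (proj₁ s)) (proj₁ (proj₂ s))
  prefix-appendSeq ((j , [] , t) , zero , tp) = cong (_+ 1) (cong suc (+-suc j (suc (j + 0))))
  prefix-appendSeq ((j , [] , t) , suc p , tp) = refl
  prefix-appendSeq ((j , x ∷ r , t) , zero , tp) = sym (suc-pred (nextBound (bound j) (x ∷ r))
    {{ >-nonZero (nextBound-pos (bound j) (x ∷ r) z<s (T-∧₁ (validRev (bound j) (x ∷ r)) _ (T-∧₂ (suc (length r) + j ≡ᵇ k) _ t))) }})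
  prefix-appendSeq ((j , x ∷ r , t) , suc p , tp) = refl

  empty-appendSeq : ∀ s → emptySeq (appendSeq s) ≡ emptySeq (proj₁ s) ∧ (proj₁ (proj₂ s) ≡ᵇ 0)
  empty-appendSeq ((j , [] , t) , zero , tp) = refl
  empty-appendSeq ((j , [] , t) , suc p , tp) = refl
  empty-appendSeq ((j , x ∷ r , t) , p , tp) = refl

  weight-appendSeq : ∀ s → weightSeq (appendSeq s) ≡ weightSeq (proj₁ s) + proj₁ (proj₂ s) + proj₁ (proj₂ s)
  weight-appendSeq ((j , [] , t) , zero , tp) = refl
  weight-appendSeq ((j , [] , t) , suc p , tp) = double-+ (suc p) 0
  weight-appendSeq ((j , x ∷ r , t) , p , tp) = double-+ p (weightL (x ∷ r))

-- §6  Reversed sequences versus the sequences of Defs.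

stepBound : ℕ → ℕ → ℕ
stepBound b x = if x ≡ᵇ 1 then suc b else x

checkList : ℕ → List ℕ → Bool
checkList b [] = true
checkList b (x ∷ l) = (1 ≤ᵇ x) ∧ (x ≤ᵇ b) ∧ checkList (stepBound b x) l

boundAfter : ℕ → List ℕ → ℕ
boundAfter b [] = b
boundAfter b (x ∷ l) = boundAfter (stepBound b x) l

checkA≡checkList : ∀ {ℓ} b (a : Vec ℕ ℓ) → checkA b a ≡ checkList b (toList a)
checkA≡checkList b [] = refl
checkA≡checkList b (x ∷ a) with x ≡ᵇ 1
... | true = cong (λ z → (1 ≤ᵇ x) ∧ (x ≤ᵇ b) ∧ z) (checkA≡checkList (suc b) a)
... | false = cong (λ z → (1 ≤ᵇ x) ∧ (x ≤ᵇ b) ∧ z) (checkA≡checkList x a)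

checkList-snoc : ∀ b l x → checkList b (l ++ x ∷ []) ≡ checkList b l ∧ ((1 ≤ᵇ x) ∧ (x ≤ᵇ boundAfter b l))
checkList-snoc b [] x = cong ((1 ≤ᵇ x) ∧_) (∧-identityʳ (x ≤ᵇ b))
checkList-snoc b (y ∷ l) x = begin
    (1 ≤ᵇ y) ∧ (y ≤ᵇ b) ∧ checkList (stepBound b y) (l ++ x ∷ [])
  ≡⟨ cong (λ z → (1 ≤ᵇ y) ∧ (y ≤ᵇ b) ∧ z) (checkList-snoc (stepBound b y) l x) ⟩
    (1 ≤ᵇ y) ∧ (y ≤ᵇ b) ∧ (checkList (stepBound b y) l ∧ C)
  ≡⟨ cong ((1 ≤ᵇ y) ∧_) (sym (∧-assoc (y ≤ᵇ b) _ C)) ⟩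
    (1 ≤ᵇ y) ∧ ((y ≤ᵇ b) ∧ checkList (stepBound b y) l) ∧ C
  ≡⟨ sym (∧-assoc (1 ≤ᵇ y) _ C) ⟩
    ((1 ≤ᵇ y) ∧ (y ≤ᵇ b) ∧ checkList (stepBound b y) l) ∧ C ∎
  where
  open ≡-Reasoning
  C = (1 ≤ᵇ x) ∧ (x ≤ᵇ boundAfter (stepBound b y) l)

boundAfter-snoc : ∀ b l x → boundAfter b (l ++ x ∷ []) ≡ stepBound (boundAfter b l) x
boundAfter-snoc b [] x = refl
boundAfter-snoc b (y ∷ l) x = boundAfter-snoc (stepBound b y) l x

nextBound≡boundAfter : ∀ b r → nextBound b r ≡ boundAfter b (reverse r)
nextBound≡boundAfter b [] = refl
nextBound≡boundAfter b (x ∷ r) = trans (cong (λ z → stepBound z x) (nextBound≡boundAfter b r))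
  (trans (sym (boundAfter-snoc b (reverse r) x)) (cong (boundAfter b) (sym (unfold-reverse x r))))

validRev≡checkList : ∀ b r → validRev b r ≡ checkList b (reverse r)
validRev≡checkList b [] = refl
validRev≡checkList b (x ∷ r) =
  trans (cong₂ (λ u v → u ∧ ((1 ≤ᵇ x) ∧ (x ≤ᵇ v))) (validRev≡checkList b r) (nextBound≡boundAfter b r))
  (trans (sym (checkList-snoc b (reverse r) x)) (cong (checkList b) (sym (unfold-reverse x r))))

headNot1 : List ℕ → Bool
headNot1 [] = true
headNot1 (x ∷ _) = not (x ≡ᵇ 1)

firstNot1≡headNot1 : ∀ r → firstNot1 r ≡ headNot1 (reverse r)
firstNot1≡headNot1 [] = refl
firstNot1≡headNot1 (x ∷ []) = refl
firstNot1≡headNot1 (x ∷ y ∷ r) = trans (firstNot1≡headNot1 (y ∷ r)) (trans (cong headNot1 (unfold-reverse y r))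
  (trans (sym (headNot1-snoc (reverse r) y x))
    (cong headNot1 (trans (cong (_++ x ∷ []) (sym (unfold-reverse y r))) (sym (unfold-reverse x (y ∷ r)))))))
  where
  headNot1-snoc : ∀ l y x → headNot1 ((l ++ y ∷ []) ++ x ∷ []) ≡ headNot1 (l ++ y ∷ [])
  headNot1-snoc [] y x = refl
  headNot1-snoc (z ∷ l) y x = refl

inB≡inBRev : ∀ {ℓ} b (a : Vec ℕ ℓ) → inB b a ≡ inBRev b (reverse (toList a))
inB≡inBRev b [] = refl
inB≡inBRev b (x ∷ a) = sym (trans (cong₂ _∧_ (validRev≡checkList b r) (firstNot1≡headNot1 r))
  (trans (cong (λ l → checkList b l ∧ headNot1 l) (reverse-involutive (toList (x ∷ a))))
    (cong (_∧ not (x ≡ᵇ 1)) (sym (checkA≡checkList b (x ∷ a))))))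
  where r = reverse (toList (x ∷ a))

AllPositive : List ℕ → Set
AllPositive [] = ⊤
AllPositive (x ∷ l) = (1 ≤ x) × AllPositive l

checkList-positive : ∀ b l → T (checkList b l) → AllPositive l
checkList-positive b [] _ = tt
checkList-positive b (x ∷ l) t = ≤ᵇ⇒≤ 1 x (T-∧₁ (1 ≤ᵇ x) _ t) ,
  checkList-positive (stepBound b x) l (T-∧₂ (x ≤ᵇ b) _ (T-∧₂ (1 ≤ᵇ x) _ t))

length≤sum : ∀ l → AllPositive l → length l ≤ sum l
length≤sum [] _ = z≤n
length≤sum (x ∷ l) (p , ps) = +-mono-≤ p (length≤sum l ps)

sum∸length : ∀ l → AllPositive l → sum l ∸ length l ≡ weightL l
sum∸length [] _ = refl
sum∸length (suc x ∷ l) (_ , ps) = trans (+-∸-assoc x (length≤sum l ps)) (cong (x +_) (sum∸length l ps))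

weightL-++ : ∀ l m → weightL (l ++ m) ≡ weightL l + weightL m
weightL-++ [] m = refl
weightL-++ (x ∷ l) m = trans (cong (pred x +_) (weightL-++ l m)) (sym (+-assoc (pred x) _ _))

weightL-reverse : ∀ l → weightL (reverse l) ≡ weightL l
weightL-reverse [] = refl
weightL-reverse (x ∷ l) = trans (cong weightL (unfold-reverse x l)) (trans (weightL-++ (reverse l) (x ∷ []))
  (trans (cong₂ _+_ (weightL-reverse l) (+-identityʳ (pred x))) (+-comm (weightL l) (pred x))))

sum-toList : ∀ {ℓ} (a : Vec ℕ ℓ) → Vec.sum a ≡ sum (toList a)
sum-toList [] = refl
sum-toList (x ∷ a) = cong (x +_) (sum-toList a)

length-toList : ∀ {ℓ} (a : Vec ℕ ℓ) → length (toList a) ≡ ℓ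
length-toList [] = refl
length-toList (x ∷ a) = cong suc (length-toList a)

weightB≡weightL : ∀ {ℓ} b (a : Vec ℕ ℓ) → T (inB b a) → weightB a ≡ weightL (reverse (toList a))
weightB≡weightL {ℓ} b a t = trans (cong₂ _∸_ (sum-toList a) (sym (length-toList a)))
  (trans (sum∸length (toList a) positive) (sym (weightL-reverse (toList a))))
  where
  t' : T (inBRev b (reverse (toList a)))
  t' = subst T (inB≡inBRev b a) t
  positive : AllPositive (toList a)
  positive = checkList-positive b (toList a) (subst (λ l → T (checkList b l)) (reverse-involutive (toList a))
    (subst T (validRev≡checkList b (reverse (toList a))) (T-∧₁ _ _ t')))

SeqB : ℕ → Set
SeqB k = Σ (Fin (suc k)) (λ j′ → Σ (Vec ℕ (k ∸ toℕ j′)) (λ a → T (inB (2 * suc (toℕ j′) + 1) a)))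

weightSeqB : ∀ {k} → SeqB k → ℕ
weightSeqB (j′ , a , _) = 2 * weightB a

fromList : (l : List ℕ) (m : ℕ) → length l ≡ m → Vec ℕ m
fromList [] zero e = []
fromList (x ∷ l) (suc m) e = x ∷ fromList l m (suc-injective e)

toList-fromList : ∀ l m e → toList (fromList l m e) ≡ l
toList-fromList [] zero e = refl
toList-fromList (x ∷ l) (suc m) e = cong (x ∷_) (toList-fromList l m (suc-injective e))

toList-injective : ∀ {m} (u v : Vec ℕ m) → toList u ≡ toList v → u ≡ v
toList-injective [] [] _ = refl
toList-injective (x ∷ u) (y ∷ v) e = cong₂ _∷_ (∷-injectiveˡ e) (toList-injective u v (∷-injectiveʳ e))

module _ {k : ℕ} where

  SeqB-≡ : ∀ {j₁ j₂ : Fin (suc k)} {a₁ a₂ t₁ t₂} → j₁ ≡ j₂ → toList a₁ ≡ toList a₂ →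
    _≡_ {A = SeqB k} (j₁ , a₁ , t₁) (j₂ , a₂ , t₂)
  SeqB-≡ {a₁ = a₁} {a₂} {t₁} {t₂} refl e with toList-injective a₁ a₂ e
  ... | refl = cong (λ z → _ , _ , z) (T-irrelevant t₁ t₂)

  private
    module FromSeq (j : ℕ) (r : List ℕ) (t : T (isSeq k j r)) where
      j≤k : j ≤ k
      j≤k = subst (j ≤_) (≡ᵇ⇒≡ _ _ (T-∧₁ (length r + j ≡ᵇ k) _ t)) (m≤n+m j (length r))
      j′ : Fin (suc k)
      j′ = fromℕ< (s≤s j≤k)
      toℕj′ : toℕ j′ ≡ j
      toℕj′ = toℕ-fromℕ< (s≤s j≤k)
      length-ok : length (reverse r) ≡ k ∸ toℕ j′
      length-ok = trans (length-reverse r) (trans (sym (m+n∸n≡m (length r) j))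
        (cong₂ _∸_ (≡ᵇ⇒≡ _ _ (T-∧₁ (length r + j ≡ᵇ k) _ t)) (sym toℕj′)))
      a : Vec ℕ (k ∸ toℕ j′)
      a = fromList (reverse r) (k ∸ toℕ j′) length-ok
      reverse-a : reverse (toList a) ≡ r
      reverse-a = trans (cong reverse (toList-fromList (reverse r) _ length-ok)) (reverse-involutive r)
      a∈B : T (inB (2 * suc (toℕ j′) + 1) a)
      a∈B = subst T (sym (trans (inB≡inBRev _ a) (cong (inBRev _) reverse-a)))
        (subst (λ z → T (inBRev (bound z) r)) (sym toℕj′) (T-∧₂ (length r + j ≡ᵇ k) _ t))

    toSeqB : Seq k → SeqB k
    toSeqB (j , r , t) = FromSeq.j′ j r t , FromSeq.a j r t , FromSeq.a∈B j r t

    isSeq-reverse : ∀ (j′ : Fin (suc k)) (a : Vec ℕ (k ∸ toℕ j′)) →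
      T (inB (2 * suc (toℕ j′) + 1) a) → T (isSeq k (toℕ j′) (reverse (toList a)))
    isSeq-reverse j′ a t = ∧-intro (length (reverse (toList a)) + toℕ j′ ≡ᵇ k) _
      (≡⇒≡ᵇ _ _ (trans (cong (_+ toℕ j′) (trans (length-reverse (toList a)) (length-toList a)))
        (m∸n+n≡m (≤-pred (toℕ<n j′)))))
      (subst T (inB≡inBRev _ a) t)

    fromSeqB : SeqB k → Seq k
    fromSeqB (j′ , a , t) = toℕ j′ , reverse (toList a) , isSeq-reverse j′ a t

  Seq↔SeqB : Seq k ↔ SeqB k
  Seq↔SeqB = mk↔ₛ′ toSeqB fromSeqB to∘from from∘to
    where
    to∘from : ∀ y → toSeqB (fromSeqB y) ≡ y
    to∘from (j′ , a , t) = SeqB-≡ (fromℕ<-toℕ j′ _)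
      (trans (toList-fromList _ _ (FromSeq.length-ok (toℕ j′) (reverse (toList a)) (isSeq-reverse j′ a t)))
        (reverse-involutive (toList a)))
    from∘to : ∀ z → fromSeqB (toSeqB z) ≡ z
    from∘to (j , r , t) = Seq-≡ (FromSeq.toℕj′ j r t) (FromSeq.reverse-a j r t)

  weight-Seq↔SeqB : ∀ z → weightSeqB (Inverse.to Seq↔SeqB z) ≡ weightSeq z
  weight-Seq↔SeqB (j , r , t) = cong (2 *_) (trans (weightB≡weightL _ (FromSeq.a j r t) (FromSeq.a∈B j r t))
    (cong weightL (FromSeq.reverse-a j r t)))

-- §7  Growth towers.

-- A family of sets A k with three statistics, in which every element of
-- A (k+1) arises from a unique a ∈ A k and slot p ≤ prefix a, the statistics of
-- the result being determined by those of a and by p alone.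
record Tower (A : ℕ → Set) : Set where
  field
    prefix : ∀ {k} → A k → ℕ
    full : ∀ {k} → A k → Bool
    weight : ∀ {k} → A k → ℕ
    grow : ∀ k → A (suc k) ↔ Slots (A k) prefix
    prefix-grow : ∀ {k} (s : Slots (A k) prefix) →
      prefix (Inverse.from (grow k) s) ≡ nextPrefix (prefix (proj₁ s)) (full (proj₁ s)) (proj₁ (proj₂ s))
    full-grow : ∀ {k} (s : Slots (A k) prefix) →
      full (Inverse.from (grow k) s) ≡ full (proj₁ s) ∧ (proj₁ (proj₂ s) ≡ᵇ 0)
    weight-grow : ∀ {k} (s : Slots (A k) prefix) →
      weight (Inverse.from (grow k) s) ≡ weight (proj₁ s) + proj₁ (proj₂ s) + proj₁ (proj₂ s)

module _ {A B : ℕ → Set} (𝒜 : Tower A) (ℬ : Tower B) where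
  open Tower
  open Inverse

  Preserves : ∀ {k} → A k ↔ B k → Set
  Preserves φ = ∀ a → (prefix ℬ (to φ a) ≡ prefix 𝒜 a) × (full ℬ (to φ a) ≡ full 𝒜 a) × (weight ℬ (to φ a) ≡ weight 𝒜 a)

  -- A statistics-preserving bijection at level k lifts to level k+1:
  -- decompose, transport the slot along φ, and recompose.
  tower-step : ∀ {k} (φ : A k ↔ B k) → Preserves φ → Σ (A (suc k) ↔ B (suc k)) Preserves
  tower-step {k} φ hφ = ψ , preserves
    where
    transport : Slots (A k) (prefix 𝒜) ↔ Slots (B k) (prefix ℬ)
    transport = Σ-↔ φ (λ {a} → Upto-cong (sym (proj₁ (hφ a))))
    ψ : A (suc k) ↔ B (suc k)
    ψ = ↔-trans (grow 𝒜 k) (↔-trans transport (↔-sym (grow ℬ k)))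
    preserves : Preserves ψ
    preserves a' =
      same prefix (trans (prefix-grow ℬ s') (cong₂ (λ u v → nextPrefix u v p) (proj₁ (hφ a)) (proj₁ (proj₂ (hφ a)))))
        (prefix-grow 𝒜 s) ,
      same full (trans (full-grow ℬ s') (cong (_∧ (p ≡ᵇ 0)) (proj₁ (proj₂ (hφ a))))) (full-grow 𝒜 s) ,
      same weight (trans (weight-grow ℬ s') (cong (λ z → z + p + p) (proj₂ (proj₂ (hφ a))))) (weight-grow 𝒜 s)
      where
      s = to (grow 𝒜 k) a'
      a = proj₁ s
      p = proj₁ (proj₂ s)
      s' = to transport s
      -- ψ a' and a' are rebuilt from slots with the same statistics.
      same : ∀ {C : Set} (stat : ∀ {F : ℕ → Set} → Tower F → ∀ {k} → F k → C) {x : C} →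
        stat ℬ (from (grow ℬ k) s') ≡ x → stat 𝒜 (from (grow 𝒜 k) s) ≡ x → stat ℬ (to ψ a') ≡ stat 𝒜 a'
      same stat eℬ e𝒜 = trans eℬ (trans (sym e𝒜) (cong (stat 𝒜) (strictlyInverseʳ (grow 𝒜 k) a')))

  tower-iso : (φ₀ : A 0 ↔ B 0) → Preserves φ₀ → ∀ k → Σ (A k ↔ B k) Preserves
  tower-iso φ₀ h₀ zero = φ₀ , h₀
  tower-iso φ₀ h₀ (suc k) = tower-step (proj₁ (tower-iso φ₀ h₀ k)) (proj₂ (tower-iso φ₀ h₀ k))

-- size k = 2k + 2, with the recursion that FI's growth step follows.
size : ℕ → ℕ
size zero = 2
size (suc k) = suc (suc (size k))

size≡ : ∀ k → size k ≡ 2 * suc k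
size≡ zero = refl
size≡ (suc k) = trans (cong (λ z → suc (suc z)) (size≡ k)) (sym (*-suc 2 (suc k)))

FI-tower : Tower (λ k → FI (size k))
FI-tower = record
  { prefix = prefixFI ; full = λ {k} x → prefixFI x ≡ᵇ size k ; weight = coinvFI
  ; grow = λ k → growFI ; prefix-grow = prefix-insertFI ; full-grow = full-insertFI ; weight-grow = coinv-insertFI }

Seq-tower : Tower Seq
Seq-tower = record
  { prefix = prefixSeq ; full = emptySeq ; weight = weightSeq
  ; grow = λ k → growSeq ; prefix-grow = prefix-appendSeq ; full-grow = empty-appendSeq ; weight-grow = weight-appendSeq }

-- Both bases are singletons: FI 2 = {21}, with prefix 2, and Seq 0 = {(0 , [])}, with bound 3.
base : Σ (FI 2 ↔ Seq 0) (Preserves FI-tower Seq-tower)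
base = mk↔ₛ′ (λ _ → 0 , [] , tt) (λ _ → descending , tt) to∘from from∘to , preserves
  where
  descending : Vec (Fin 2) 2
  descending = fsuc fzero ∷ fzero ∷ []
  to∘from : ∀ (z : Seq 0) → (0 , [] , tt) ≡ z
  to∘from (zero , [] , t) = refl
  to∘from (suc j , [] , ())
  to∘from (j , x ∷ r , ())
  from∘to : ∀ (x : FI 2) → (descending , tt) ≡ x
  from∘to (fzero ∷ fzero ∷ [] , ())
  from∘to (fzero ∷ fsuc fzero ∷ [] , ())
  from∘to (fsuc fzero ∷ fzero ∷ [] , t) = refl
  from∘to (fsuc fzero ∷ fsuc fzero ∷ [] , ())
  preserves : ∀ (x : FI 2) → _
  preserves (fzero ∷ fzero ∷ [] , ())
  preserves (fzero ∷ fsuc fzero ∷ [] , ())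
  preserves (fsuc fzero ∷ fzero ∷ [] , t) = refl , refl , refl
  preserves (fsuc fzero ∷ fsuc fzero ∷ [] , ())

FI↔SeqB : ∀ k → Σ (FI (size k) ↔ SeqB k) (λ φ → ∀ x → weightSeqB (Inverse.to φ x) ≡ coinvFI x)
FI↔SeqB k = ↔-trans φ Seq↔SeqB , λ x → trans (weight-Seq↔SeqB (Inverse.to φ x)) (proj₂ (proj₂ (preserves x)))
  where
  φ = proj₁ (tower-iso FI-tower Seq-tower (proj₁ base) (proj₂ base) k)
  preserves = proj₂ (tower-iso FI-tower Seq-tower (proj₁ base) (proj₂ base) k)

Σ-∧↔ : ∀ {A : Set} (P R : A → Bool) → Σ (Σ A (λ a → T (P a))) (λ x → T (R (proj₁ x))) ↔ Σ A (λ a → T (P a ∧ R a))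
Σ-∧↔ P R = mk↔ₛ′ (λ ((a , s) , t) → a , ∧-intro (P a) (R a) s t) (λ (a , u) → (a , T-∧₁ (P a) (R a) u) , T-∧₂ (P a) (R a) u)
  (λ _ → Σ-T-≡ refl) (λ ((a , s) , t) → cong₂ (λ s t → (a , s) , t) (T-irrelevant _ s) (T-irrelevant _ t))

level-set↔ : ∀ {A B : Set} (f : A → ℕ) (g : B → ℕ) (φ : A ↔ B) → (∀ a → g (Inverse.to φ a) ≡ f a) →
  ∀ d → Σ A (λ a → T (f a ≡ᵇ d)) ↔ Σ B (λ b → T (g b ≡ᵇ d))
level-set↔ f g φ e d = Σ-↔ φ (λ {a} → subst (λ z → T (f a ≡ᵇ d) ↔ T (z ≡ᵇ d)) (sym (e a)) ↔-refl)

corollary3p22 : (k′ d : ℕ) →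
    (Σ (Vec (Fin (2 * suc k′)) (2 * suc k′))
       (λ ι → T (inFI123 ι ∧ (coinv ι ≡ᵇ d))))
    ↔
    (Σ (Fin (suc k′)) (λ j′ →
       Σ (Vec ℕ (suc k′ ∸ suc (toℕ j′)))
         (λ a → T (inB (2 * suc (toℕ j′) + 1) a ∧ (2 * weightB a ≡ᵇ d)))))
corollary3p22 k′ d = subst (λ n → LHS n ↔ RHS) (size≡ k′) bijection
  where
  LHS : ℕ → Set
  LHS n = Σ (Vec (Fin n) n) (λ ι → T (inFI123 ι ∧ (coinv ι ≡ᵇ d)))
  RHS : Set
  RHS = Σ (Fin (suc k′)) (λ j′ → Σ (Vec ℕ (k′ ∸ toℕ j′))
          (λ a → T (inB (2 * suc (toℕ j′) + 1) a ∧ (2 * weightB a ≡ᵇ d))))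
  bijection : LHS (size k′) ↔ RHS
  bijection = ↔-trans (↔-sym (Σ-∧↔ inFI123 (λ ι → coinv ι ≡ᵇ d)))
    (↔-trans (level-set↔ coinvFI weightSeqB (proj₁ (FI↔SeqB k′)) (proj₂ (FI↔SeqB k′)) d)
    (↔-trans Σ-assoc-alt (Σ-↔ ↔-refl (Σ-∧↔ _ (λ a → 2 * weightB a ≡ᵇ d)))))
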